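{- Let $|q|<1$ and $x\in\mathbb{C}$. Then \[ \sum_{n\geq 1} \frac{q^{2n^2-2n}\prod_{i=1}^n (1+2xq^{2i-1}+q^{4i-2})}{(q^2;q^2)_{2n-1}} =\frac{1}{(q^2;q^2)_\infty}\sum_{n\geq 0} q^{4n^2-2n}(1-q^{12n+6})\sum_{j=0}^n q^{ -j^2}\big(V_j(x)+V_{j-1}(x)\big). \]
   Context: $(a;q)_n=\prod_{k=0}^{n-1}(1-aq^k)$, $(a;q)_\infty=\prod_{k\ge0}(1-aq^k)$. $V_n(x)$ is the Chebyshev polynomial of the third kind: $V_0=1$, $V_1=2x-1$, $V_n=2xV_{n-1}-V_{n-2}$ ($n>1$), and $V_n=0$ for $n<0$. (The paper writes the left sum over $n\ge0$ with the convention that the $n=0$ summand is zero.) -}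

module Defs where

open import Algebra.Bundles using (CommutativeRing)
open import Data.Nat as ℕ using (ℕ; zero; suc; _∸_; _≡ᵇ_)
open import Data.Nat.DivMod using (_%_)
open import Data.Bool using (if_then_else_)

-- Formal power series in q with coefficients in a commutative ring R,
-- represented by their coefficient sequences  ℕ → Carrier.
module Series {c ℓ} (R : CommutativeRing c ℓ) where
  open CommutativeRing R

  PS : Set c
  PS = ℕ → Carrier

  Σ< : ℕ → (ℕ → Carrier) → Carrier
  Σ< zero    f = 0#
  Σ< (suc n) f = Σ< n f + f n

  Σ≤ : ℕ → (ℕ → Carrier) → Carrier
  Σ≤ n f = Σ< (suc n) f

  _⊕_ : PS → PS → PS
  (f ⊕ g) n = f n + g n

  ⊖_ : PS → PS
  (⊖ f) n = - f n

  _·_ : Carrier → PS → PS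
  (a · f) n = a * f n

  _⊗_ : PS → PS → PS
  (f ⊗ g) n = Σ≤ n (λ k → f k * g (n ∸ k))

  one : PS
  one zero    = 1#
  one (suc n) = 0#

  mono : ℕ → PS
  mono k n = if k ≡ᵇ n then 1# else 0#

  prodPS : ℕ → (ℕ → PS) → PS
  prodPS zero    f = one
  prodPS (suc n) f = prodPS n f ⊗ f n

  -- geo m = 1/(1 - q^(m+1)) = Σ_{j≥0} q^((m+1) j)
  geo : ℕ → PS
  geo m n = if (n % suc m) ≡ᵇ 0 then 1# else 0#

  -- 1/(q^2;q^2)_m = Π_{k=1}^{m} 1/(1 - q^(2k))   (factor k+1 has exponent 2k+2 = suc (2k+1))
  invPoch : ℕ → PS
  invPoch m = prodPS m (λ k → geo (suc (2 ℕ.* k)))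

  -- 1/(q^2;q^2)_∞ : the coefficient of q^n agrees with that of 1/(q^2;q^2)_n,
  -- since the omitted factors 1/(1-q^(2k)), k > n, only affect degrees > n.
  invPochInf : PS
  invPochInf n = invPoch n n

  -- infinite sum Σ_{n≥0} f n of a family with ord(f n) ≥ n
  -- (the coefficient of q^N only receives contributions from n ≤ N)
  tsum : (ℕ → PS) → PS
  tsum f N = Σ≤ N (λ n → f n N)

  V : Carrier → ℕ → Carrier
  V x zero          = 1#
  V x (suc zero)    = (x + x) + - 1#
  V x (suc (suc n)) = (x + x) * V x (suc n) + - V x n

  -- V_{j-1}(x), with V_{-1} = 0
  Vpred : Carrier → ℕ → Carrier
  Vpred x zero    = 0#
  Vpred x (suc j) = V x j

  -- LHS summand with index n = m + 1 (n ≥ 1):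
  --   q^(2n²-2n) Π_{i=1}^{n} (1 + 2x q^(2i-1) + q^(4i-2)) / (q^2;q^2)_(2n-1)
  -- here 2n²-2n = 2m²+2m, 2n-1 = 2m+1, and factor i = k+1 has 2i-1 = 2k+1, 4i-2 = 4k+2.
  lhsTerm : Carrier → ℕ → PS
  lhsTerm x m =
    (mono (2 ℕ.* m ℕ.* m ℕ.+ 2 ℕ.* m)
      ⊗ prodPS (suc m) (λ k → (one ⊕ ((x + x) · mono (2 ℕ.* k ℕ.+ 1))) ⊕ mono (4 ℕ.* k ℕ.+ 2)))
      ⊗ invPoch (2 ℕ.* m ℕ.+ 1)

  LHS : Carrier → PS
  LHS x = tsum (lhsTerm x)

  -- RHS summand n:
  --   q^(4n²-2n) (1 - q^(12n+6)) Σ_{j=0}^{n} q^(-j²) (V_j(x) + V_{j-1}(x))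
  -- the exponents 4n²-2n-j² (j ≤ n) are natural numbers.
  rhsTerm : Carrier → ℕ → PS
  rhsTerm x n =
    (one ⊕ (⊖ mono (12 ℕ.* n ℕ.+ 6)))
      ⊗ (λ k → Σ≤ n (λ j → (V x j + Vpred x j) * mono ((4 ℕ.* n ℕ.* n ∸ 2 ℕ.* n) ∸ j ℕ.* j) k))

  RHS : Carrier → PS
  RHS x = invPochInf ⊗ tsum (rhsTerm x)

module Submission where

-- Write p = q². Both sides expand in the basis W_j = V_j + V_(j-1), which satisfies
-- 2x W_j = W_(j+1) + W_(j-1). On the left this comes from the finite expansion
--   Π_(i=1..n) (1 + 2x q^(2i-1) + q^(4i-2)) / (p;p)_(2n) = Σ_(j≤n) W_j q^(j²) / ((p;p)_(n-j) (p;p)_(n+j)),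
-- proved by induction on n from a three-term recurrence in j of the summands; on the right it is
-- immediate. It remains to compare the coefficients of each W_j. Multiplied by q^(j²), both coefficients
-- drop by the same amount (1 - q^(12j+6)) q^(4j²-2j) / (p;p)_∞ when j increases by one (on the left by
-- Cauchy's identity Σ_m p^(m²+am) / ((p;p)_m (p;p)_(m+a)) = 1 / (p;p)_∞), and both have q-adic order
-- at least j, so they coincide.

open import Algebra.Bundles using (CommutativeRing)
open import Algebra.Structures using (IsCommutativeRing)
open import Algebra.Solver.Ring.AlmostCommutativeRing using (fromCommutativeRing; _-Raw-AlmostCommutative⟶_)
open import Data.Nat as ℕ using (ℕ; zero; suc; _∸_; _<_; _≤_; z≤n; s≤s)
import Data.Nat.Properties as ℕP
open import Data.Integer as ℤ using (ℤ; +_; -[1+_]; _⊖_; _◃_; sign; ∣_∣)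
import Data.Integer.Properties as ℤP
open import Data.Sign as Sign using (Sign)
open import Data.Maybe using (Maybe; just; nothing)
open import Data.Product using (_,_)
open import Relation.Nullary using (yes; no)
open import Data.Empty using (⊥-elim)
open import Data.Sum using (inj₁; inj₂)
open import Data.Bool using (if_then_else_)
open import Data.Nat.DivMod using (_%_; [m+n]%n≡m%n; m<n⇒m%n≡m)
open import Function using (_∘_)
open import Relation.Binary.PropositionalEquality using (_≡_; _≢_)
import Relation.Binary.PropositionalEquality as ≡
open import Data.List using (_∷_; [])
import Data.Nat.Tactic.RingSolver as ℕSolver
open import Defs

module IntegerCoefficients {c ℓ} (R : CommutativeRing c ℓ) where
  open CommutativeRing R
  open import Relation.Binary.Reasoning.Setoid setoid
  open import Algebra.Properties.Monoid.Mult.TCOptimised +-monoid using (_×_; ×-homo-+; 1+×)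
  open import Algebra.Properties.Semiring.Mult.TCOptimised semiring using (×1-homo-*)
  open import Algebra.Properties.Ring ring using (-‿distribˡ-*; -‿distribʳ-*; -‿involutive; -‿+-comm; -0#≈0#)
  open import Algebra.Properties.CommutativeSemigroup +-commutativeSemigroup using () renaming (interchange to +-interchange)
  open import Algebra.Properties.CommutativeSemigroup *-commutativeSemigroup using () renaming (interchange to *-interchange)

  ⟦_⟧ℤ : ℤ → Carrier
  ⟦ + n ⟧ℤ      = n × 1#
  ⟦ -[1+ n ] ⟧ℤ = - (suc n × 1#)

  ⟦_⟧ₛ : Sign → Carrier
  ⟦ Sign.+ ⟧ₛ = 1#
  ⟦ Sign.- ⟧ₛ = - 1#

  ⟦⟧ₛ-homo-* : ∀ s t → ⟦ s Sign.* t ⟧ₛ ≈ ⟦ s ⟧ₛ * ⟦ t ⟧ₛ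
  ⟦⟧ₛ-homo-* Sign.+ t      = sym (*-identityˡ _)
  ⟦⟧ₛ-homo-* Sign.- Sign.+ = sym (*-identityʳ _)
  ⟦⟧ₛ-homo-* Sign.- Sign.- = begin
    1#            ≈⟨ sym (-‿involutive 1#) ⟩
    - - 1#        ≈⟨ -‿cong (sym (*-identityʳ _)) ⟩
    - (- 1# * 1#) ≈⟨ -‿distribʳ-* _ _ ⟩
    - 1# * - 1#   ∎

  ⟦◃⟧ : ∀ s n → ⟦ s ◃ n ⟧ℤ ≈ ⟦ s ⟧ₛ * (n × 1#)
  ⟦◃⟧ s      zero    = sym (zeroʳ _)
  ⟦◃⟧ Sign.+ (suc n) = sym (*-identityˡ _)
  ⟦◃⟧ Sign.- (suc n) = trans (-‿cong (sym (*-identityˡ _))) (-‿distribˡ-* _ _)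

  ⟦sign*abs⟧ : ∀ i → ⟦ i ⟧ℤ ≈ ⟦ sign i ⟧ₛ * (∣ i ∣ × 1#)
  ⟦sign*abs⟧ (+ n)    = sym (*-identityˡ _)
  ⟦sign*abs⟧ -[1+ n ] = trans (-‿cong (sym (*-identityˡ _))) (-‿distribˡ-* _ _)

  ⟦⊖⟧ : ∀ m n → ⟦ m ⊖ n ⟧ℤ ≈ m × 1# - n × 1#
  ⟦⊖⟧ zero    zero    = sym (-‿inverseʳ _)
  ⟦⊖⟧ zero    (suc n) = sym (+-identityˡ _)
  ⟦⊖⟧ (suc m) zero    = sym (trans (+-congˡ -0#≈0#) (+-identityʳ _))
  ⟦⊖⟧ (suc m) (suc n) = begin
    ⟦ suc m ⊖ suc n ⟧ℤ          ≡⟨ ≡.cong ⟦_⟧ℤ (ℤP.[1+m]⊖[1+n]≡m⊖n m n) ⟩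
    ⟦ m ⊖ n ⟧ℤ                  ≈⟨ ⟦⊖⟧ m n ⟩
    a - b                       ≈⟨ +-identityˡ (a - b) ⟨
    0# + (a - b)                ≈⟨ +-congʳ (-‿inverseʳ 1#) ⟨
    (1# - 1#) + (a - b)         ≈⟨ +-interchange 1# a (- 1#) (- b) ⟨
    (1# + a) + (- 1# - b)       ≈⟨ +-congˡ (-‿+-comm 1# b) ⟩
    (1# + a) - (1# + b)         ≈⟨ +-cong (1+× m 1#) (-‿cong (1+× n 1#)) ⟨
    suc m × 1# - suc n × 1#     ∎
    where
    a = m × 1#
    b = n × 1#

  ⟦⟧ℤ-homo-+ : ∀ i j → ⟦ i ℤ.+ j ⟧ℤ ≈ ⟦ i ⟧ℤ + ⟦ j ⟧ℤ
  ⟦⟧ℤ-homo-+ (+ m)    (+ n)    = ×-homo-+ 1# m n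
  ⟦⟧ℤ-homo-+ (+ m)    -[1+ n ] = ⟦⊖⟧ m (suc n)
  ⟦⟧ℤ-homo-+ -[1+ m ] (+ n)    = trans (⟦⊖⟧ n (suc m)) (+-comm _ _)
  ⟦⟧ℤ-homo-+ -[1+ m ] -[1+ n ] = begin
    - (suc (suc (m ℕ.+ n)) × 1#)         ≡⟨ ≡.cong (λ k → - (suc k × 1#)) (ℕP.+-suc m n) ⟨
    - ((suc m ℕ.+ suc n) × 1#)           ≈⟨ -‿cong (×-homo-+ 1# (suc m) (suc n)) ⟩
    - (suc m × 1# + suc n × 1#)          ≈⟨ -‿+-comm _ _ ⟨
    - (suc m × 1#) + - (suc n × 1#)      ∎

  ⟦⟧ℤ-homo-* : ∀ i j → ⟦ i ℤ.* j ⟧ℤ ≈ ⟦ i ⟧ℤ * ⟦ j ⟧ℤ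
  ⟦⟧ℤ-homo-* i j = begin
    ⟦ (sign i Sign.* sign j) ◃ (∣ i ∣ ℕ.* ∣ j ∣) ⟧ℤ      ≈⟨ ⟦◃⟧ (sign i Sign.* sign j) (∣ i ∣ ℕ.* ∣ j ∣) ⟩
    ⟦ sign i Sign.* sign j ⟧ₛ * ((∣ i ∣ ℕ.* ∣ j ∣) × 1#) ≈⟨ *-cong (⟦⟧ₛ-homo-* (sign i) (sign j)) (×1-homo-* ∣ i ∣ ∣ j ∣) ⟩
    (s * t) * (m * n)                                    ≈⟨ *-interchange s t m n ⟩
    (s * m) * (t * n)                                    ≈⟨ sym (*-cong (⟦sign*abs⟧ i) (⟦sign*abs⟧ j)) ⟩
    ⟦ i ⟧ℤ * ⟦ j ⟧ℤ                                      ∎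
    where
    s = ⟦ sign i ⟧ₛ
    t = ⟦ sign j ⟧ₛ
    m = ∣ i ∣ × 1#
    n = ∣ j ∣ × 1#

  ⟦⟧ℤ-homo-- : ∀ i → ⟦ ℤ.- i ⟧ℤ ≈ - ⟦ i ⟧ℤ
  ⟦⟧ℤ-homo-- (+ zero)  = sym -0#≈0#
  ⟦⟧ℤ-homo-- (+ suc n) = refl
  ⟦⟧ℤ-homo-- -[1+ n ]  = sym (-‿involutive _)

  ℤ⟶R : ℤ.+-*-rawRing -Raw-AlmostCommutative⟶ fromCommutativeRing R
  ℤ⟶R = record
    { ⟦_⟧    = ⟦_⟧ℤ
    ; +-homo = ⟦⟧ℤ-homo-+
    ; *-homo = ⟦⟧ℤ-homo-*
    ; -‿homo = ⟦⟧ℤ-homo--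
    ; 0-homo = refl
    ; 1-homo = refl
    }

  ⟦⟧ℤ-≟ : ∀ i j → Maybe (⟦ i ⟧ℤ ≈ ⟦ j ⟧ℤ)
  ⟦⟧ℤ-≟ i j with i ℤ.≟ j
  ... | yes ≡.refl = just refl
  ... | no _       = nothing

  open import Algebra.Solver.Ring ℤ.+-*-rawRing (fromCommutativeRing R) ℤ⟶R ⟦⟧ℤ-≟ public

  𝟘 𝟙 : ∀ {n} → Polynomial n
  𝟘 = con (+ 0)
  𝟙 = con (+ 1)

module FiniteSums {c ℓ} (R : CommutativeRing c ℓ) where
  open CommutativeRing R
  open Series R using (Σ<; Σ≤)
  open import Relation.Binary.Reasoning.Setoid setoid

  Σ-cong-< : ∀ n {f g} → (∀ i → i < n → f i ≈ g i) → Σ< n f ≈ Σ< n g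
  Σ-cong-< zero    f≈g = refl
  Σ-cong-< (suc n) f≈g = +-cong (Σ-cong-< n (λ i i<n → f≈g i (ℕP.m<n⇒m<1+n i<n))) (f≈g n ℕP.≤-refl)

  Σ-cong : ∀ n {f g} → (∀ i → f i ≈ g i) → Σ< n f ≈ Σ< n g
  Σ-cong n f≈g = Σ-cong-< n (λ i _ → f≈g i)

  Σ-zero-< : ∀ n {f} → (∀ i → i < n → f i ≈ 0#) → Σ< n f ≈ 0#
  Σ-zero-< zero    f≈0 = refl
  Σ-zero-< (suc n) f≈0 =
    trans (+-cong (Σ-zero-< n (λ i i<n → f≈0 i (ℕP.m<n⇒m<1+n i<n))) (f≈0 n ℕP.≤-refl)) (+-identityˡ 0#)

  Σ-distrib-+ : ∀ n f g → Σ< n (λ i → f i + g i) ≈ Σ< n f + Σ< n g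
  Σ-distrib-+ zero    f g = sym (+-identityˡ 0#)
  Σ-distrib-+ (suc n) f g = begin
    Σ< n (λ i → f i + g i) + (f n + g n) ≈⟨ +-congʳ (Σ-distrib-+ n f g) ⟩
    (Σ< n f + Σ< n g) + (f n + g n)      ≈⟨ interchange _ _ _ _ ⟩
    (Σ< n f + f n) + (Σ< n g + g n)      ∎
    where open import Algebra.Properties.CommutativeSemigroup +-commutativeSemigroup using (interchange)

  *-distribˡ-Σ : ∀ n a f → a * Σ< n f ≈ Σ< n (λ i → a * f i)
  *-distribˡ-Σ zero    a f = zeroʳ a
  *-distribˡ-Σ (suc n) a f = trans (distribˡ a _ _) (+-congʳ (*-distribˡ-Σ n a f))

  *-distribʳ-Σ : ∀ n a f → Σ< n f * a ≈ Σ< n (λ i → f i * a)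
  *-distribʳ-Σ n a f = trans (*-comm _ a) (trans (*-distribˡ-Σ n a f) (Σ-cong n (λ i → *-comm a (f i))))

  -‿distrib-Σ : ∀ n f → - Σ< n f ≈ Σ< n (λ i → - f i)
  -‿distrib-Σ zero    f = -0#≈0#
    where open import Algebra.Properties.Ring ring using (-0#≈0#)
  -‿distrib-Σ (suc n) f = trans (sym (-‿+-comm _ _)) (+-congʳ (-‿distrib-Σ n f))
    where open import Algebra.Properties.Ring ring using (-‿+-comm)

  Σ-head : ∀ n f → Σ< (suc n) f ≈ f 0 + Σ< n (λ i → f (suc i))
  Σ-head zero    f = trans (+-identityˡ _) (sym (+-identityʳ _))
  Σ-head (suc n) f = trans (+-congʳ (Σ-head n f)) (+-assoc _ _ _)

  Σ-reverse : ∀ n f → Σ< n f ≈ Σ< n (λ i → f (n ∸ suc i))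
  Σ-reverse zero    f = refl
  Σ-reverse (suc n) f = begin
    Σ< n f + f n                             ≈⟨ +-congʳ (Σ-reverse n f) ⟩
    Σ< n (λ i → f (n ∸ suc i)) + f n         ≈⟨ +-comm _ _ ⟩
    f n + Σ< n (λ i → f (n ∸ suc i))         ≈⟨ Σ-head n (λ i → f (suc n ∸ suc i)) ⟨
    Σ< (suc n) (λ i → f (suc n ∸ suc i))     ∎

  Σ-extend : ∀ {n m f} → n ≤ m → (∀ i → n ≤ i → f i ≈ 0#) → Σ< m f ≈ Σ< n f
  Σ-extend {n} {m} {f} n≤m f≈0 = begin
    Σ< m f                ≡⟨ ≡.cong (λ k → Σ< k f) (ℕP.m∸n+n≡m n≤m) ⟨
    Σ< ((m ∸ n) ℕ.+ n) f  ≈⟨ pad (m ∸ n) ⟩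
    Σ< n f                ∎
    where
    pad : ∀ k → Σ< (k ℕ.+ n) f ≈ Σ< n f
    pad zero    = refl
    pad (suc k) = trans (+-cong (pad k) (f≈0 (k ℕ.+ n) (ℕP.m≤n+m n k))) (+-identityʳ _)

  Σ-swap : ∀ a b (h : ℕ → ℕ → Carrier) → Σ< a (λ k → Σ< b (h k)) ≈ Σ< b (λ n → Σ< a (λ k → h k n))
  Σ-swap zero    b h = sym (Σ-zero-< b (λ _ _ → refl))
  Σ-swap (suc a) b h = trans (+-congʳ (Σ-swap a b h)) (sym (Σ-distrib-+ b _ _))

  Σ-triangle : ∀ n (h : ℕ → ℕ → Carrier) →
               Σ≤ n (λ k → Σ≤ k (h k)) ≈ Σ≤ n (λ i → Σ≤ (n ∸ i) (λ m → h (m ℕ.+ i) i))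
  Σ-triangle zero    h = refl
  Σ-triangle (suc n) h = begin
    Σ≤ n (λ k → Σ≤ k (h k)) + (Σ≤ n (h (suc n)) + h (suc n) (suc n))
      ≈⟨ +-congʳ (Σ-triangle n h) ⟩
    Σ≤ n (λ i → Σ≤ (n ∸ i) (column i)) + (Σ≤ n (h (suc n)) + h (suc n) (suc n))
      ≈⟨ +-assoc _ _ _ ⟨
    (Σ≤ n (λ i → Σ≤ (n ∸ i) (column i)) + Σ≤ n (h (suc n))) + h (suc n) (suc n)
      ≈⟨ +-cong (sym (Σ-distrib-+ (suc n) _ _)) lastColumn ⟩
    Σ≤ n (λ i → Σ≤ (n ∸ i) (column i) + h (suc n) i) + Σ≤ (suc n ∸ suc n) (column (suc n))
      ≈⟨ +-congʳ (Σ-cong-< (suc n) extendColumn) ⟩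
    Σ≤ n (λ i → Σ≤ (suc n ∸ i) (column i)) + Σ≤ (suc n ∸ suc n) (column (suc n)) ∎
    where
    column : ℕ → ℕ → Carrier
    column i m = h (m ℕ.+ i) i
    lastColumn : h (suc n) (suc n) ≈ Σ≤ (suc n ∸ suc n) (column (suc n))
    lastColumn = begin
      h (suc n) (suc n)                 ≈⟨ +-identityˡ _ ⟨
      Σ≤ 0 (column (suc n))             ≡⟨ ≡.cong (λ k → Σ≤ k (column (suc n))) (ℕP.n∸n≡0 n) ⟨
      Σ≤ (suc n ∸ suc n) (column (suc n)) ∎
    extendColumn : ∀ i → i < suc n → Σ≤ (n ∸ i) (column i) + h (suc n) i ≈ Σ≤ (suc n ∸ i) (column i)
    extendColumn i (s≤s i≤n) = begin
      Σ≤ (n ∸ i) (column i) + h (suc n) i      ≡⟨ ≡.cong (λ k → Σ≤ (n ∸ i) (column i) + h (suc k) i) (ℕP.m∸n+n≡m i≤n) ⟨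
      Σ≤ (suc (n ∸ i)) (column i)              ≡⟨ ≡.cong (λ k → Σ≤ k (column i)) (ℕP.+-∸-assoc 1 i≤n) ⟨
      Σ≤ (suc n ∸ i) (column i)                ∎

module PowerSeriesRing {c ℓ} (R : CommutativeRing c ℓ) where
  open CommutativeRing R
  open Series R
  open FiniteSums R
  open import Relation.Binary.Reasoning.Setoid setoid

  infix 4 _≈ₚ_
  _≈ₚ_ : PS → PS → Set ℓ
  f ≈ₚ g = ∀ n → f n ≈ g n

  zeroₚ : PS
  zeroₚ _ = 0#

  ⊗-cong : ∀ {f f′ g g′} → f ≈ₚ f′ → g ≈ₚ g′ → f ⊗ g ≈ₚ f′ ⊗ g′
  ⊗-cong f≈f′ g≈g′ n = Σ-cong (suc n) (λ k → *-cong (f≈f′ k) (g≈g′ (n ∸ k)))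

  ⊗-comm : ∀ f g → f ⊗ g ≈ₚ g ⊗ f
  ⊗-comm f g n = begin
    Σ≤ n (λ k → f k * g (n ∸ k))               ≈⟨ Σ-reverse (suc n) _ ⟩
    Σ≤ n (λ k → f (n ∸ k) * g (n ∸ (n ∸ k)))   ≈⟨ Σ-cong-< (suc n) swap ⟩
    Σ≤ n (λ k → g k * f (n ∸ k))               ∎
    where
    swap : ∀ k → k < suc n → f (n ∸ k) * g (n ∸ (n ∸ k)) ≈ g k * f (n ∸ k)
    swap k (s≤s k≤n) = trans (*-comm _ _) (*-congʳ (reflexive (≡.cong g (ℕP.m∸[m∸n]≡n k≤n))))

  ⊗-assoc : ∀ f g h → (f ⊗ g) ⊗ h ≈ₚ f ⊗ (g ⊗ h)
  ⊗-assoc f g h n = begin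
    Σ≤ n (λ k → Σ≤ k (λ i → f i * g (k ∸ i)) * h (n ∸ k))                    ≈⟨ Σ-cong (suc n) (λ k → *-distribʳ-Σ (suc k) _ _) ⟩
    Σ≤ n (λ k → Σ≤ k (λ i → (f i * g (k ∸ i)) * h (n ∸ k)))                  ≈⟨ Σ-triangle n _ ⟩
    Σ≤ n (λ i → Σ≤ (n ∸ i) (λ m → (f i * g (m ℕ.+ i ∸ i)) * h (n ∸ (m ℕ.+ i)))) ≈⟨ Σ-cong (suc n) (λ i → Σ-cong (suc (n ∸ i)) (reindex i)) ⟩
    Σ≤ n (λ i → Σ≤ (n ∸ i) (λ m → f i * (g m * h (n ∸ i ∸ m))))               ≈⟨ Σ-cong (suc n) (λ i → *-distribˡ-Σ (suc (n ∸ i)) _ _) ⟨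
    Σ≤ n (λ i → f i * Σ≤ (n ∸ i) (λ m → g m * h (n ∸ i ∸ m)))                 ∎
    where
    reindex : ∀ i m → (f i * g (m ℕ.+ i ∸ i)) * h (n ∸ (m ℕ.+ i)) ≈ f i * (g m * h (n ∸ i ∸ m))
    reindex i m = trans (*-assoc _ _ _) (*-congˡ (*-cong (reflexive (≡.cong g (ℕP.m+n∸n≡m m i)))
                    (reflexive (≡.cong h (≡.trans (≡.cong (n ∸_) (ℕP.+-comm m i)) (≡.sym (ℕP.∸-+-assoc n i m)))))))

  ⊗-identityˡ : ∀ f → one ⊗ f ≈ₚ f
  ⊗-identityˡ f n = begin
    Σ≤ n (λ k → one k * f (n ∸ k))                    ≈⟨ Σ-head n _ ⟩
    1# * f n + Σ< n (λ k → 0# * f (n ∸ suc k))        ≈⟨ +-cong (*-identityˡ _) (Σ-zero-< n (λ i _ → zeroˡ _)) ⟩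
    f n + 0#                                          ≈⟨ +-identityʳ _ ⟩
    f n                                               ∎

  ⊗-distribʳ : ∀ f g h → (g ⊕ h) ⊗ f ≈ₚ (g ⊗ f) ⊕ (h ⊗ f)
  ⊗-distribʳ f g h n = trans (Σ-cong (suc n) (λ k → distribʳ _ _ _)) (Σ-distrib-+ (suc n) _ _)

  ⊗-isCommutativeRing : IsCommutativeRing _≈ₚ_ _⊕_ _⊗_ ⊖_ zeroₚ one
  ⊗-isCommutativeRing = record
    { isRing = record
      { +-isAbelianGroup = record
        { isGroup = record
          { isMonoid = record
            { isSemigroup = record
              { isMagma = record
                { isEquivalence = record { refl = λ n → refl ; sym = λ f≈g n → sym (f≈g n) ; trans = λ f≈g g≈h n → trans (f≈g n) (g≈h n) }
                ; ∙-cong = λ f≈f′ g≈g′ n → +-cong (f≈f′ n) (g≈g′ n) }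
              ; assoc = λ f g h n → +-assoc _ _ _ }
            ; identity = (λ f n → +-identityˡ _) , (λ f n → +-identityʳ _) }
          ; inverse = (λ f n → -‿inverseˡ _) , (λ f n → -‿inverseʳ _)
          ; ⁻¹-cong = λ f≈g n → -‿cong (f≈g n) }
        ; comm = λ f g n → +-comm _ _ }
      ; *-cong = ⊗-cong
      ; *-assoc = ⊗-assoc
      ; *-identity = ⊗-identityˡ , (λ f n → trans (⊗-comm f one n) (⊗-identityˡ f n))
      ; distrib = (λ f g h n → trans (⊗-comm f (g ⊕ h) n) (trans (⊗-distribʳ f g h n) (+-cong (⊗-comm g f n) (⊗-comm h f n))))
                , ⊗-distribʳ }
    ; *-comm = ⊗-comm }

  -- The ring multiplication is an opaque copy of _⊗_: once _⊗_ unfolds, its second factor only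
  -- occurs at the index n ∸ k, where unification cannot recover it.
  infixl 7 _⊛_
  opaque
    _⊛_ : PS → PS → PS
    _⊛_ = _⊗_

    ⊛≡⊗ : _⊛_ ≡ _⊗_
    ⊛≡⊗ = ≡.refl

  ⊛≈⊗ : ∀ f g → f ⊛ g ≈ₚ f ⊗ g
  ⊛≈⊗ f g n = reflexive (≡.cong (λ _∙_ → (f ∙ g) n) ⊛≡⊗)

  powerSeriesRing : CommutativeRing c ℓ
  powerSeriesRing = record
    { isCommutativeRing = ≡.subst (λ _∙_ → IsCommutativeRing _≈ₚ_ _⊕_ _∙_ ⊖_ zeroₚ one) (≡.sym ⊛≡⊗) ⊗-isCommutativeRing }

module PowerSeries {c ℓ} (R : CommutativeRing c ℓ) where
  open CommutativeRing R
  open Series R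
  open FiniteSums R
  open PowerSeriesRing R public
  module ℙ = CommutativeRing powerSeriesRing
  open import Relation.Binary.Reasoning.Setoid setoid
  open import Algebra.Properties.Ring ring using (-0#≈0#)

  ≈ₚ-split : ∀ k {f g : PS} → (∀ n → n < k → f n ≈ g n) → (∀ m → f (k ℕ.+ m) ≈ g (k ℕ.+ m)) → f ≈ₚ g
  ≈ₚ-split k {f} {g} low high n with n ℕ.<? k
  ... | yes n<k = low n n<k
  ... | no  n≮k = ≡.subst (λ t → f t ≈ g t) (ℕP.m+[n∸m]≡n (ℕP.≮⇒≥ n≮k)) (high (n ∸ k))

  mono-≢ : ∀ {k n} → k ≢ n → mono k n ≈ 0#
  mono-≢ {zero}  {zero}  k≢n = ⊥-elim (k≢n ≡.refl)
  mono-≢ {zero}  {suc n} k≢n = refl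
  mono-≢ {suc k} {zero}  k≢n = refl
  mono-≢ {suc k} {suc n} k≢n = mono-≢ (k≢n ∘ ≡.cong suc)

  mono-diag : ∀ k → mono k k ≈ 1#
  mono-diag zero    = refl
  mono-diag (suc k) = mono-diag k

  mono-shift : ∀ a k n → mono (a ℕ.+ k) (a ℕ.+ n) ≡ mono k n
  mono-shift zero    k n = ≡.refl
  mono-shift (suc a) k n = mono-shift a k n

  mono-cong : ∀ {a b} → a ≡ b → mono a ≈ₚ mono b
  mono-cong a≡b = ℙ.reflexive (≡.cong mono a≡b)

  mono-0 : mono 0 ≈ₚ one
  mono-0 zero    = refl
  mono-0 (suc n) = refl

  Σ-mono-below : ∀ m k (h : ℕ → Carrier) → m ≤ k → Σ< m (λ i → mono k i * h i) ≈ 0#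
  Σ-mono-below m k h m≤k =
    Σ-zero-< m (λ i i<m → trans (*-congʳ (mono-≢ (ℕP.>⇒≢ (ℕP.<-≤-trans i<m m≤k)))) (zeroˡ _))

  Σ-mono-pick : ∀ m k (h : ℕ → Carrier) → k < m → Σ< m (λ i → mono k i * h i) ≈ h k
  Σ-mono-pick (suc m) k h (s≤s k≤m) with ℕP.m≤n⇒m<n∨m≡n k≤m
  ... | inj₁ k<m = begin
    Σ< m (λ i → mono k i * h i) + mono k m * h m  ≈⟨ +-cong (Σ-mono-pick m k h k<m) (trans (*-congʳ (mono-≢ (ℕP.<⇒≢ k<m))) (zeroˡ _)) ⟩
    h k + 0#                                      ≈⟨ +-identityʳ _ ⟩
    h k                                           ∎
  ... | inj₂ ≡.refl = begin
    Σ< k (λ i → mono k i * h i) + mono k k * h k  ≈⟨ +-cong (Σ-mono-below k k h ℕP.≤-refl) (trans (*-congʳ (mono-diag k)) (*-identityˡ _)) ⟩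
    0# + h k                                      ≈⟨ +-identityˡ _ ⟩
    h k                                           ∎

  mono-⊛-shift : ∀ k f n → (mono k ⊛ f) (k ℕ.+ n) ≈ f n
  mono-⊛-shift k f n = trans (⊛≈⊗ (mono k) f (k ℕ.+ n)) (trans (Σ-mono-pick (suc (k ℕ.+ n)) k _ (s≤s (ℕP.m≤m+n k n)))
                             (reflexive (≡.cong f (ℕP.m+n∸m≡n k n))))

  mono-⊛-below : ∀ k f n → n < k → (mono k ⊛ f) n ≈ 0#
  mono-⊛-below k f n n<k = trans (⊛≈⊗ (mono k) f n) (Σ-mono-below (suc n) k _ n<k)

  mono-+ : ∀ a b → mono a ⊛ mono b ≈ₚ mono (a ℕ.+ b)
  mono-+ a b = ≈ₚ-split a low high
    where
    low : ∀ n → n < a → (mono a ⊛ mono b) n ≈ mono (a ℕ.+ b) n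
    low n n<a = trans (mono-⊛-below a (mono b) n n<a) (sym (mono-≢ (ℕP.>⇒≢ (ℕP.<-≤-trans n<a (ℕP.m≤m+n a b)))))
    high : ∀ m → (mono a ⊛ mono b) (a ℕ.+ m) ≈ mono (a ℕ.+ b) (a ℕ.+ m)
    high m = trans (mono-⊛-shift a (mono b) m) (reflexive (≡.sym (mono-shift a b m)))

  mono-cancel : ∀ k {f g} → mono k ⊛ f ≈ₚ mono k ⊛ g → f ≈ₚ g
  mono-cancel k {f} {g} kf≈kg n = trans (sym (mono-⊛-shift k f n)) (trans (kf≈kg (k ℕ.+ n)) (mono-⊛-shift k g n))

  const : Carrier → PS
  const a = a · one

  ·≈const-⊛ : ∀ a f → a · f ≈ₚ const a ⊛ f
  ·≈const-⊛ a f n = sym (begin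
    (const a ⊛ f) n                                               ≈⟨ ⊛≈⊗ (const a) f n ⟩
    Σ≤ n (λ i → (a * one i) * f (n ∸ i))                          ≈⟨ Σ-head n _ ⟩
    (a * 1#) * f n + Σ< n (λ i → (a * 0#) * f (n ∸ suc i))        ≈⟨ +-cong (*-congʳ (*-identityʳ a)) (Σ-zero-< n (λ i _ → trans (*-congʳ (zeroʳ a)) (zeroˡ _))) ⟩
    a * f n + 0#                                                  ≈⟨ +-identityʳ _ ⟩
    a * f n                                                       ∎)

  const-cong : ∀ {a b} → a ≈ b → const a ≈ₚ const b
  const-cong a≈b n = *-congʳ a≈b

  const-+ : ∀ a b → const (a + b) ≈ₚ const a ⊕ const b
  const-+ a b n = distribʳ _ a b

  const-* : ∀ a b → const (a * b) ≈ₚ const a ⊛ const b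
  const-* a b n = trans (*-assoc a b _) (·≈const-⊛ a (const b) n)

  const-0 : const 0# ≈ₚ zeroₚ
  const-0 n = zeroˡ _

  const-1 : const 1# ≈ₚ one
  const-1 n = *-identityˡ _

  Ord≥ : ℕ → PS → Set ℓ
  Ord≥ k f = ∀ n → n < k → f n ≈ 0#

  Ord≥-0 : ∀ {f} → Ord≥ 0 f
  Ord≥-0 n ()

  Ord≥-weaken : ∀ {a b f} → a ≤ b → Ord≥ b f → Ord≥ a f
  Ord≥-weaken a≤b f≥b n n<a = f≥b n (ℕP.<-≤-trans n<a a≤b)

  Ord≥-resp : ∀ {k f g} → f ≈ₚ g → Ord≥ k f → Ord≥ k g
  Ord≥-resp f≈g f≥k n n<k = trans (sym (f≈g n)) (f≥k n n<k)

  Ord≥-⊕ : ∀ {k f g} → Ord≥ k f → Ord≥ k g → Ord≥ k (f ⊕ g)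
  Ord≥-⊕ f≥k g≥k n n<k = trans (+-cong (f≥k n n<k) (g≥k n n<k)) (+-identityʳ 0#)

  Ord≥-⊖ : ∀ {k f} → Ord≥ k f → Ord≥ k (⊖ f)
  Ord≥-⊖ f≥k n n<k = trans (-‿cong (f≥k n n<k)) -0#≈0#

  Ord≥-⊛ : ∀ a b {f g} → Ord≥ a f → Ord≥ b g → Ord≥ (a ℕ.+ b) (f ⊛ g)
  Ord≥-⊛ a b {f} {g} f≥a g≥b n n<a+b = trans (⊛≈⊗ f g n) (Σ-zero-< (suc n) term)
    where
    term : ∀ i → i < suc n → f i * g (n ∸ i) ≈ 0#
    term i (s≤s i≤n) with i ℕ.<? a
    ... | yes i<a = trans (*-congʳ (f≥a i i<a)) (zeroˡ _)
    ... | no  i≮a = trans (*-congˡ (g≥b (n ∸ i) n-i<b)) (zeroʳ _)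
      where
      n-i<b : n ∸ i < b
      n-i<b = ℕP.+-cancelˡ-< i (n ∸ i) b (≡.subst (_< i ℕ.+ b) (≡.sym (ℕP.m+[n∸m]≡n i≤n))
                (ℕP.<-≤-trans n<a+b (ℕP.+-monoˡ-≤ b (ℕP.≮⇒≥ i≮a))))

  Ord≥-⊛ˡ : ∀ a {f g} → Ord≥ a f → Ord≥ a (f ⊛ g)
  Ord≥-⊛ˡ a f≥a = Ord≥-weaken (ℕP.m≤m+n a 0) (Ord≥-⊛ a 0 f≥a Ord≥-0)

  Ord≥-⊛ʳ : ∀ b {f g} → Ord≥ b g → Ord≥ b (f ⊛ g)
  Ord≥-⊛ʳ b g≥b = Ord≥-⊛ 0 b Ord≥-0 g≥b

  Ord≥-mono : ∀ k → Ord≥ k (mono k)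
  Ord≥-mono k n n<k = mono-≢ (ℕP.>⇒≢ n<k)

  Ord≥-mono-⊛ : ∀ {a} k {f} → a ≤ k → Ord≥ a (mono k ⊛ f)
  Ord≥-mono-⊛ k a≤k = Ord≥-weaken a≤k (Ord≥-⊛ˡ k (Ord≥-mono k))

  Ord≥-all⇒≈0 : ∀ {f} → (∀ k → Ord≥ k f) → f ≈ₚ zeroₚ
  Ord≥-all⇒≈0 f≥ n = f≥ (suc n) n ℕP.≤-refl

  infix 25 1-q^_ q²^_ 1-q²^_

  1-q^_ : ℕ → PS
  1-q^ k = one ⊕ (⊖ mono k)

  q²^_ : ℕ → PS
  q²^ e = mono (2 ℕ.* e)

  1-q²^_ : ℕ → PS
  1-q²^ e = 1-q^ (2 ℕ.* e)

  q²^-+ : ∀ x y → q²^ x ⊛ q²^ y ≈ₚ q²^ (x ℕ.+ y)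
  q²^-+ x y = ℙ.trans (mono-+ (2 ℕ.* x) (2 ℕ.* y)) (mono-cong (≡.sym (ℕP.*-distribˡ-+ 2 x y)))

  q²^-regroup : ∀ x y z w → x ℕ.+ y ≡ z ℕ.+ w → q²^ x ⊛ q²^ y ≈ₚ q²^ z ⊛ q²^ w
  q²^-regroup x y z w e = ℙ.trans (q²^-+ x y) (ℙ.trans (mono-cong (≡.cong (2 ℕ.*_) e)) (ℙ.sym (q²^-+ z w)))

  1-q²^0 : 1-q²^ 0 ≈ₚ zeroₚ
  1-q²^0 n = trans (+-congˡ (-‿cong (mono-0 n))) (-‿inverseʳ _)

  geo-below : ∀ m n → n < suc m → geo m n ≈ one n
  geo-below m zero    n<m = refl
  geo-below m (suc n) n<m = reflexive (≡.cong (λ r → if r ℕ.≡ᵇ 0 then 1# else 0#) (m<n⇒m%n≡m n<m))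

  geo-periodic : ∀ m n → geo m (suc m ℕ.+ n) ≡ geo m n
  geo-periodic m n = ≡.cong (λ r → if r ℕ.≡ᵇ 0 then 1# else 0#)
                       (≡.trans (≡.cong (_% suc m) (ℕP.+-comm (suc m) n)) ([m+n]%n≡m%n n (suc m)))

  geo-inverse : ∀ m → (1-q^ suc m) ⊛ geo m ≈ₚ one
  geo-inverse m = ℙ.trans (ℙ.trans (ℙ.distribʳ (geo m) one (⊖ mono (suc m))) (ℙ.+-cong (ℙ.*-identityˡ (geo m)) (ℙ.sym (-‿distribˡ-⊛ (mono (suc m)) (geo m)))))
                          (≈ₚ-split (suc m) low high)
    where
    open import Algebra.Properties.Ring ℙ.ring using () renaming (-‿distribˡ-* to -‿distribˡ-⊛)
    low : ∀ n → n < suc m → geo m n - (mono (suc m) ⊛ geo m) n ≈ one n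
    low n n<m = trans (+-cong (geo-below m n n<m) (trans (-‿cong (mono-⊛-below (suc m) (geo m) n n<m)) -0#≈0#)) (+-identityʳ _)
    high : ∀ k → geo m (suc m ℕ.+ k) - (mono (suc m) ⊛ geo m) (suc m ℕ.+ k) ≈ 0#
    high k = trans (+-cong (reflexive (geo-periodic m k)) (-‿cong (mono-⊛-shift (suc m) (geo m) k))) (-‿inverseʳ _)

  invPoch-unfold : ∀ k → invPoch (suc k) ≈ₚ invPoch k ⊛ geo (suc (2 ℕ.* k))
  invPoch-unfold k = ℙ.sym (⊛≈⊗ (invPoch k) (geo (suc (2 ℕ.* k))))

  1-q²^-inverse : ∀ k → 1-q²^ (suc k) ⊛ geo (suc (2 ℕ.* k)) ≈ₚ one
  1-q²^-inverse k = ℙ.trans (ℙ.*-congʳ (ℙ.+-congˡ (ℙ.-‿cong (mono-cong (ℕP.*-suc 2 k))))) (geo-inverse (suc (2 ℕ.* k)))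


  invPoch-suc : ∀ k → invPoch (suc k) ⊛ 1-q²^ (suc k) ≈ₚ invPoch k
  invPoch-suc k =
    ℙ.trans (ℙ.*-congʳ (invPoch-unfold k))
    (ℙ.trans (ℙ.*-assoc _ _ _)
    (ℙ.trans (ℙ.*-congˡ (ℙ.trans (ℙ.*-comm _ _) (1-q²^-inverse k)))
             (ℙ.*-identityʳ _)))

  invPoch-cong : ∀ {k l} → k ≡ l → invPoch k ≈ₚ invPoch l
  invPoch-cong k≡l = ℙ.reflexive (≡.cong invPoch k≡l)

  invPoch-split : ∀ k {l} → suc k ≡ l → invPoch k ≈ₚ invPoch l ⊛ 1-q²^ l
  invPoch-split k ≡.refl = ℙ.sym (invPoch-suc k)

  invPoch-suc-below : ∀ k n → n < suc (suc (2 ℕ.* k)) → invPoch (suc k) n ≈ invPoch k n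
  invPoch-suc-below k n n<2k+2 = begin
    invPoch (suc k) n                                ≈⟨ invPoch-unfold k n ⟩
    (invPoch k ⊛ geo g) n                            ≈⟨ ℙ.*-congˡ geo≈1+tail n ⟩
    (invPoch k ⊛ (one ⊕ tail)) n                     ≈⟨ ℙ.distribˡ (invPoch k) one tail n ⟩
    (invPoch k ⊛ one) n + (invPoch k ⊛ tail) n       ≈⟨ +-cong (ℙ.*-identityʳ (invPoch k) n) (Ord≥-⊛ʳ (suc g) tail≥ n n<2k+2) ⟩
    invPoch k n + 0#                                 ≈⟨ +-identityʳ _ ⟩
    invPoch k n                                      ∎
    where
    g = suc (2 ℕ.* k)
    tail = geo g ⊕ (⊖ one)
    geo≈1+tail : geo g ≈ₚ one ⊕ tail
    geo≈1+tail n = sym (trans (sym (+-assoc _ _ _)) (trans (+-congʳ (+-comm _ _)) (trans (+-assoc _ _ _)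
                     (trans (+-congˡ (-‿inverseʳ _)) (+-identityʳ _)))))
    tail≥ : Ord≥ (suc g) tail
    tail≥ n n<g+1 = trans (+-congʳ (geo-below g n n<g+1)) (-‿inverseʳ _)

  invPoch-stable : ∀ t n → invPoch (n ℕ.+ t) n ≈ invPochInf n
  invPoch-stable zero    n = reflexive (≡.cong (λ m → invPoch m n) (ℕP.+-identityʳ n))
  invPoch-stable (suc t) n = begin
    invPoch (n ℕ.+ suc t) n   ≡⟨ ≡.cong (λ m → invPoch m n) (ℕP.+-suc n t) ⟩
    invPoch (suc (n ℕ.+ t)) n ≈⟨ invPoch-suc-below (n ℕ.+ t) n (s≤s (ℕP.≤-trans (ℕP.m≤m+n n t) (ℕP.≤-trans (ℕP.m≤m+n (n ℕ.+ t) _) (ℕP.n≤1+n _)))) ⟩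
    invPoch (n ℕ.+ t) n       ≈⟨ invPoch-stable t n ⟩
    invPochInf n              ∎

  infixl 7 _·ₘ_
  data Monomial : Set where
    q^⟨_⟩ : ℕ → Monomial
    _·ₘ_  : Monomial → Monomial → Monomial

  ⟦_⟧ₘ : Monomial → PS
  ⟦ q^⟨ k ⟩ ⟧ₘ = mono k
  ⟦ e ·ₘ f ⟧ₘ  = ⟦ e ⟧ₘ ⊛ ⟦ f ⟧ₘ

  degree : Monomial → ℕ
  degree q^⟨ k ⟩  = k
  degree (e ·ₘ f) = degree e ℕ.+ degree f

  ⟦⟧ₘ≈mono-degree : ∀ e → ⟦ e ⟧ₘ ≈ₚ mono (degree e)
  ⟦⟧ₘ≈mono-degree q^⟨ k ⟩  = ℙ.refl
  ⟦⟧ₘ≈mono-degree (e ·ₘ f) = ℙ.trans (ℙ.*-cong (⟦⟧ₘ≈mono-degree e) (⟦⟧ₘ≈mono-degree f)) (mono-+ (degree e) (degree f))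

  monomial-≈ : ∀ e f → degree e ≡ degree f → ⟦ e ⟧ₘ ≈ₚ ⟦ f ⟧ₘ
  monomial-≈ e f e≡f = ℙ.trans (⟦⟧ₘ≈mono-degree e) (ℙ.trans (mono-cong e≡f) (ℙ.sym (⟦⟧ₘ≈mono-degree f)))

module InfiniteSums {c ℓ} (R : CommutativeRing c ℓ) where
  open CommutativeRing R
  open Series R
  open FiniteSums R
  open PowerSeries R
  module Σₚ = Series powerSeriesRing
  open import Relation.Binary.Reasoning.Setoid setoid

  Σₚ-coeff : ∀ n (F : ℕ → PS) k → Σₚ.Σ< n F k ≈ Σ< n (λ j → F j k)
  Σₚ-coeff zero    F k = refl
  Σₚ-coeff (suc n) F k = +-congʳ (Σₚ-coeff n F k)

  Summable : (ℕ → PS) → Set ℓ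
  Summable F = ∀ n → Ord≥ n (F n)

  tsum-cong : ∀ {F G} → (∀ n → F n ≈ₚ G n) → tsum F ≈ₚ tsum G
  tsum-cong F≈G N = Σ-cong (suc N) (λ n → F≈G n N)

  tsum-⊕ : ∀ F G → tsum (λ n → F n ⊕ G n) ≈ₚ tsum F ⊕ tsum G
  tsum-⊕ F G N = Σ-distrib-+ (suc N) _ _

  tsum-⊖ : ∀ F → tsum (λ n → ⊖ F n) ≈ₚ ⊖ tsum F
  tsum-⊖ F N = sym (-‿distrib-Σ (suc N) _)

  Ord≥-tsum : ∀ k F → (∀ n → Ord≥ k (F n)) → Ord≥ k (tsum F)
  Ord≥-tsum k F F≥k N N<k = Σ-zero-< (suc N) (λ n _ → F≥k n N N<k)

  tsum-head : ∀ F → Summable F → tsum F ≈ₚ F 0 ⊕ tsum (λ n → F (suc n))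
  tsum-head F F-summable N = begin
    Σ≤ N (λ n → F n N)                   ≈⟨ Σ-head N _ ⟩
    F 0 N + Σ< N (λ n → F (suc n) N)     ≈⟨ +-congˡ (trans (+-congˡ (F-summable (suc N) N ℕP.≤-refl)) (+-identityʳ _)) ⟨
    F 0 N + Σ≤ N (λ n → F (suc n) N)     ∎

  ⊛-distribˡ-tsum : ∀ g F → Summable F → g ⊛ tsum F ≈ₚ tsum (λ n → g ⊛ F n)
  ⊛-distribˡ-tsum g F F-summable N = begin
    (g ⊛ tsum F) N                                     ≈⟨ ⊛≈⊗ g (tsum F) N ⟩
    Σ≤ N (λ k → g k * Σ≤ (N ∸ k) (λ n → F n (N ∸ k)))  ≈⟨ Σ-cong (suc N) (λ k → *-congˡ (sym (Σ-extend (s≤s (ℕP.m∸n≤m N k)) (λ n → F-summable n (N ∸ k))))) ⟩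
    Σ≤ N (λ k → g k * Σ≤ N (λ n → F n (N ∸ k)))        ≈⟨ Σ-cong (suc N) (λ k → *-distribˡ-Σ (suc N) _ _) ⟩
    Σ≤ N (λ k → Σ≤ N (λ n → g k * F n (N ∸ k)))        ≈⟨ Σ-swap (suc N) (suc N) _ ⟩
    Σ≤ N (λ n → Σ≤ N (λ k → g k * F n (N ∸ k)))        ≈⟨ Σ-cong (suc N) (λ n → ⊛≈⊗ g (F n) N) ⟨
    Σ≤ N (λ n → (g ⊛ F n) N)                           ∎

  tsum-triangle : ∀ (a : ℕ → ℕ → PS) → (∀ k j → Ord≥ (k ℕ.+ j) (a (k ℕ.+ j) j)) →
                  tsum (λ n → Σₚ.Σ≤ n (a n)) ≈ₚ tsum (λ j → tsum (λ k → a (k ℕ.+ j) j))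
  tsum-triangle a a≥ N = begin
    Σ≤ N (λ n → Σₚ.Σ≤ n (a n) N)                      ≈⟨ Σ-cong (suc N) (λ n → Σₚ-coeff (suc n) (a n) N) ⟩
    Σ≤ N (λ n → Σ≤ n (λ j → a n j N))                 ≈⟨ Σ-triangle N (λ n j → a n j N) ⟩
    Σ≤ N (λ j → Σ≤ (N ∸ j) (λ k → a (k ℕ.+ j) j N))   ≈⟨ Σ-cong (suc N) (λ j → Σ-extend (s≤s (ℕP.m∸n≤m N j)) (λ k k>N-j → a≥ k j N (N<k+j k>N-j))) ⟨
    Σ≤ N (λ j → Σ≤ N (λ k → a (k ℕ.+ j) j N))        ∎
    where
    N<k+j : ∀ {j k} → suc (N ∸ j) ≤ k → N < k ℕ.+ j
    N<k+j {j} {k} N-j<k = ℕP.≤-<-trans (ℕP.m≤n+m∸n N j) (≡.subst (_< k ℕ.+ j) (ℕP.+-comm (N ∸ j) j) (ℕP.+-monoˡ-< j N-j<k))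

  telescoping-unique : ∀ {a b c : ℕ → PS} → (∀ j → a j ≈ₚ c j ⊕ a (suc j)) → (∀ j → b j ≈ₚ c j ⊕ b (suc j)) →
                       (∀ j → Ord≥ j (a j)) → (∀ j → Ord≥ j (b j)) → ∀ j → a j ≈ₚ b j
  telescoping-unique {a} {b} a-step b-step a≥ b≥ j N = agree (suc N) j (s≤s (ℕP.m≤m+n N j))
    where
    agree : ∀ s j → N < s ℕ.+ j → a j N ≈ b j N
    agree zero    j N<j   = trans (a≥ j N N<j) (sym (b≥ j N N<j))
    agree (suc s) j N<s+j = trans (a-step j N) (trans (+-congˡ (agree s (suc j) (≡.subst (N <_) (≡.sym (ℕP.+-suc s j)) N<s+j))) (sym (b-step j N)))

module CauchyIdentity {c ℓ} (R : CommutativeRing c ℓ) where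
  open Series R using (PS; tsum; invPoch; invPochInf)
  open PowerSeries R hiding (module ℙ)
  open InfiniteSums R
  open CommutativeRing powerSeriesRing
  open IntegerCoefficients powerSeriesRing using (solve; _:=_; _:+_; _:*_; :-_; _:-_; con)
  open import Relation.Binary.Reasoning.Setoid setoid
  module Coeff = CommutativeRing R

  t : ℕ → ℕ → ℕ → PS
  t a b m = q²^ (m ℕ.* m ℕ.+ b ℕ.* m) * (invPoch m * invPoch (m ℕ.+ a))

  D : ℕ → ℕ → PS
  D a b = tsum (t a b)

  Ord≥-q²^-square : ∀ m x {f} → Ord≥ m (q²^ (m ℕ.* m ℕ.+ x) * f)
  Ord≥-q²^-square m x = Ord≥-mono-⊛ (2 ℕ.* (m ℕ.* m ℕ.+ x)) (m≤2[m*m+x] m)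
    where
    m≤2[m*m+x] : ∀ m → m ≤ 2 ℕ.* (m ℕ.* m ℕ.+ x)
    m≤2[m*m+x] zero    = z≤n
    m≤2[m*m+x] (suc k) = ℕP.≤-trans (ℕP.m≤m+n (suc k) _) (ℕP.≤-trans (ℕP.m≤m+n (suc k ℕ.* suc k) x) (ℕP.m≤m+n _ _))

  t-summable : ∀ a b → Summable (t a b)
  t-summable a b m = Ord≥-q²^-square m (b ℕ.* m)

  t-rec-a : ∀ a b m → t a b m ≈ t (suc a) b m - q²^ (suc a) * t (suc a) (suc b) m
  t-rec-a a b m = begin
    X * (Y * invPoch (m ℕ.+ a))                  ≈⟨ *-congˡ {X} (*-congˡ {Y} (invPoch-split (m ℕ.+ a) (≡.sym (ℕP.+-suc m a)))) ⟩
    X * (Y * (Z * (1# - W)))                     ≈⟨ solve 4 (λ X Y Z W → X :* (Y :* (Z :* (con (+ 1) :- W))) := X :* (Y :* Z) :- (X :* W) :* (Y :* Z)) refl X Y Z W ⟩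
    X * (Y * Z) - (X * W) * (Y * Z)              ≈⟨ +-congˡ (-‿cong (*-congʳ (q²^-regroup (m ℕ.* m ℕ.+ b ℕ.* m) (m ℕ.+ suc a) (suc a) (m ℕ.* m ℕ.+ suc b ℕ.* m) exponents))) ⟩
    X * (Y * Z) - (q²^ (suc a) * X′) * (Y * Z)   ≈⟨ +-congˡ (-‿cong (*-assoc (q²^ (suc a)) X′ (Y * Z))) ⟩
    t (suc a) b m - q²^ (suc a) * t (suc a) (suc b) m ∎
    where
    X = q²^ (m ℕ.* m ℕ.+ b ℕ.* m)
    X′ = q²^ (m ℕ.* m ℕ.+ suc b ℕ.* m)
    Y = invPoch m
    Z = invPoch (m ℕ.+ suc a)
    W = q²^ (m ℕ.+ suc a)
    exponents : (m ℕ.* m ℕ.+ b ℕ.* m) ℕ.+ (m ℕ.+ suc a) ≡ suc a ℕ.+ (m ℕ.* m ℕ.+ suc b ℕ.* m)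
    exponents = ℕSolver.solve (m ∷ a ∷ b ∷ [])

  D-rec-a : ∀ a b → D a b ≈ D (suc a) b - q²^ (suc a) * D (suc a) (suc b)
  D-rec-a a b = begin
    tsum (t a b)                                                        ≈⟨ tsum-cong (t-rec-a a b) ⟩
    tsum (λ m → t (suc a) b m - q²^ (suc a) * t (suc a) (suc b) m)      ≈⟨ tsum-⊕ _ _ ⟩
    D (suc a) b + tsum (λ m → - (q²^ (suc a) * t (suc a) (suc b) m))    ≈⟨ +-congˡ (tsum-⊖ _) ⟩
    D (suc a) b - tsum (λ m → q²^ (suc a) * t (suc a) (suc b) m)        ≈⟨ +-congˡ (-‿cong (⊛-distribˡ-tsum (q²^ (suc a)) _ (t-summable (suc a) (suc b)))) ⟨
    D (suc a) b - q²^ (suc a) * D (suc a) (suc b)                       ∎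

  u : ℕ → ℕ → ℕ → PS
  u a b m = (q²^ (m ℕ.* m ℕ.+ b ℕ.* m) * 1-q²^ m) * (invPoch m * invPoch (m ℕ.+ a))

  t-rec-b : ∀ a b m → t a b m ≈ t a (suc b) m + u a b m
  t-rec-b a b m = begin
    X * V                                  ≈⟨ solve 3 (λ X V P → X :* V := (X :* P) :* V :+ (X :* (con (+ 1) :- P)) :* V) refl X V (q²^ m) ⟩
    (X * q²^ m) * V + (X * 1-q²^ m) * V    ≈⟨ +-congʳ (*-congʳ {V} (trans (q²^-+ (m ℕ.* m ℕ.+ b ℕ.* m) m) (mono-cong (≡.cong (2 ℕ.*_) exponents)))) ⟩
    t a (suc b) m + u a b m                ∎
    where
    X = q²^ (m ℕ.* m ℕ.+ b ℕ.* m)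
    V = invPoch m * invPoch (m ℕ.+ a)
    exponents : (m ℕ.* m ℕ.+ b ℕ.* m) ℕ.+ m ≡ m ℕ.* m ℕ.+ suc b ℕ.* m
    exponents = ℕSolver.solve (m ∷ b ∷ [])

  u-zero : ∀ a b → u a b 0 ≈ 0#
  u-zero a b = trans (*-congʳ {invPoch 0 * invPoch a} (trans (*-congˡ {q²^ (b ℕ.* 0)} 1-q²^0) (zeroʳ _))) (zeroˡ _)

  u-suc : ∀ a b k → u a b (suc k) ≈ q²^ (suc b) * t (suc a) (suc (suc b)) k
  u-suc a b k = begin
    (A * 1-q²^ (suc k)) * (invPoch (suc k) * B)   ≈⟨ solve 4 (λ A O I B → (A :* O) :* (I :* B) := A :* ((I :* O) :* B)) refl A (1-q²^ (suc k)) (invPoch (suc k)) B ⟩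
    A * ((invPoch (suc k) * 1-q²^ (suc k)) * B)   ≈⟨ *-congˡ {A} (*-cong (invPoch-suc k) (invPoch-cong (≡.sym (ℕP.+-suc k a)))) ⟩
    A * (invPoch k * invPoch (k ℕ.+ suc a))       ≈⟨ *-congʳ {invPoch k * invPoch (k ℕ.+ suc a)} (trans (mono-cong (≡.cong (2 ℕ.*_) exponents)) (sym (q²^-+ (suc b) _))) ⟩
    (q²^ (suc b) * q²^ e) * (invPoch k * invPoch (k ℕ.+ suc a)) ≈⟨ *-assoc _ _ _ ⟩
    q²^ (suc b) * t (suc a) (suc (suc b)) k       ∎
    where
    A = q²^ (suc k ℕ.* suc k ℕ.+ b ℕ.* suc k)
    B = invPoch (suc k ℕ.+ a)
    e = k ℕ.* k ℕ.+ suc (suc b) ℕ.* k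
    exponents : suc k ℕ.* suc k ℕ.+ b ℕ.* suc k ≡ suc b ℕ.+ (k ℕ.* k ℕ.+ suc (suc b) ℕ.* k)
    exponents = ℕSolver.solve (k ∷ b ∷ [])

  D-rec-b : ∀ a b → D a b ≈ D a (suc b) + q²^ (suc b) * D (suc a) (suc (suc b))
  D-rec-b a b = begin
    tsum (t a b)                                                     ≈⟨ tsum-cong (t-rec-b a b) ⟩
    tsum (λ m → t a (suc b) m + u a b m)                             ≈⟨ tsum-⊕ (t a (suc b)) (u a b) ⟩
    D a (suc b) + tsum (u a b)                                       ≈⟨ +-congˡ (tsum-head (u a b) u-summable) ⟩
    D a (suc b) + (u a b 0 + tsum (λ k → u a b (suc k)))             ≈⟨ +-congˡ (+-cong (u-zero a b) (tsum-cong (u-suc a b))) ⟩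
    D a (suc b) + (0# + tsum (λ k → q²^ (suc b) * t (suc a) (suc (suc b)) k)) ≈⟨ +-congˡ (+-identityˡ _) ⟩
    D a (suc b) + tsum (λ k → q²^ (suc b) * t (suc a) (suc (suc b)) k)        ≈⟨ +-congˡ (⊛-distribˡ-tsum (q²^ (suc b)) _ (t-summable (suc a) (suc (suc b)))) ⟨
    D a (suc b) + q²^ (suc b) * D (suc a) (suc (suc b))              ∎
    where
    u-summable : Summable (u a b)
    u-summable m = Ord≥-⊛ˡ m {q²^ (m ℕ.* m ℕ.+ b ℕ.* m) * 1-q²^ m} (Ord≥-q²^-square m (b ℕ.* m))

  D-diagonal-difference : ∀ a → D a a - D (suc a) (suc a) ≈ - (q²^ (suc a) * (D (suc a) (suc a) - D (suc (suc a)) (suc (suc a))))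
  D-diagonal-difference a = begin
    D a a - D₁                        ≈⟨ +-congʳ (trans (D-rec-a a a) (+-congʳ (D-rec-b (suc a) a))) ⟩
    ((D₁ + P * D₂) - P * D₁) - D₁     ≈⟨ solve 3 (λ D₁ D₂ P → ((D₁ :+ P :* D₂) :- P :* D₁) :- D₁ := :- (P :* (D₁ :- D₂))) refl D₁ D₂ P ⟩
    - (P * (D₁ - D₂))                 ∎
    where
    P = q²^ (suc a)
    D₁ = D (suc a) (suc a)
    D₂ = D (suc (suc a)) (suc (suc a))

  Ord≥-D-difference : ∀ K a → Ord≥ K (D a a - D (suc a) (suc a))
  Ord≥-D-difference zero    a = Ord≥-0
  Ord≥-D-difference (suc K) a = Ord≥-resp (sym (D-diagonal-difference a))
    (Ord≥-⊖ (Ord≥-weaken (s≤s (ℕP.m≤n+m K _)) (Ord≥-⊛ (2 ℕ.* suc a) K (Ord≥-mono (2 ℕ.* suc a)) (Ord≥-D-difference K (suc a)))))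

  D-diagonal-suc : ∀ a → D a a ≈ D (suc a) (suc a)
  D-diagonal-suc a = begin
    D a a                 ≈⟨ solve 2 (λ A B → A := (A :- B) :+ B) refl (D a a) D₁ ⟩
    (D a a - D₁) + D₁     ≈⟨ +-congʳ (Ord≥-all⇒≈0 (λ K → Ord≥-D-difference K a)) ⟩
    0# + D₁               ≈⟨ +-identityˡ D₁ ⟩
    D₁                    ∎
    where D₁ = D (suc a) (suc a)

  D-diagonal-+ : ∀ s a → D a a ≈ D (s ℕ.+ a) (s ℕ.+ a)
  D-diagonal-+ zero    a = refl
  D-diagonal-+ (suc s) a = trans (D-diagonal-+ s a) (D-diagonal-suc (s ℕ.+ a))

  D-diagonal-coeff : ∀ N s → D (N ℕ.+ s) (N ℕ.+ s) N Coeff.≈ invPochInf N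
  D-diagonal-coeff N s = Coeff.trans (tsum-head (t K K) (t-summable K K) N)
    (Coeff.trans (Coeff.+-cong (t-zero N) (tail≥ N (s≤s (ℕP.m≤m+n N s))))
    (Coeff.trans (Coeff.+-identityʳ _) (invPoch-stable s N)))
    where
    K = N ℕ.+ s
    t-zero : t K K 0 ≈ invPoch K
    t-zero = trans (*-cong (trans (mono-cong (≡.cong (2 ℕ.*_) (ℕP.*-zeroʳ K))) mono-0) (*-identityˡ (invPoch K))) (*-identityˡ (invPoch K))
    K<2e : ∀ m → suc K ≤ 2 ℕ.* (suc m ℕ.* suc m ℕ.+ K ℕ.* suc m)
    K<2e m = ℕP.≤-trans (ℕP.+-mono-≤ (s≤s z≤n) (ℕP.m≤m*n K (suc m))) (ℕP.m≤m+n (suc m ℕ.* suc m ℕ.+ K ℕ.* suc m) _)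
    tail≥ : Ord≥ (suc K) (tsum (λ m → t K K (suc m)))
    tail≥ = Ord≥-tsum (suc K) _ (λ m → Ord≥-mono-⊛ (2 ℕ.* (suc m ℕ.* suc m ℕ.+ K ℕ.* suc m)) (K<2e m))

  cauchy : ∀ a → D a a ≈ invPochInf
  cauchy a N = Coeff.trans (D-diagonal-+ N a N) (D-diagonal-coeff N a)

module Chebyshev {c ℓ} (R : CommutativeRing c ℓ) (x : CommutativeRing.Carrier R) where
  open CommutativeRing R
  open Series R using (V; Vpred)
  open IntegerCoefficients R using (solve; _:=_; _:+_; _:*_; :-_; con)

  W : ℕ → Carrier
  W j = V x j + Vpred x j

  -- W₋ j plays W (j - 1) in the recurrence, except that W₋ 1 = 2 W 0: W j = 2 T_j for j ≥ 1, but W 0 = 1.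
  W₋ : ℕ → Carrier
  W₋ zero          = 0#
  W₋ (suc zero)    = 1# + 1#
  W₋ (suc (suc j)) = W (suc j)

  W-recurrence : ∀ j → (x + x) * W j ≈ W (suc j) + W₋ j
  W-recurrence zero = solve 1 (λ x → (x :+ x) :* (con (+ 1) :+ con (+ 0))
                                    := (((x :+ x) :+ :- con (+ 1)) :+ con (+ 1)) :+ con (+ 0)) refl x
  W-recurrence (suc zero) = solve 1 (λ x → (x :+ x) :* (((x :+ x) :+ :- con (+ 1)) :+ con (+ 1))
                                          := (((x :+ x) :* ((x :+ x) :+ :- con (+ 1)) :+ :- con (+ 1)) :+ ((x :+ x) :+ :- con (+ 1))) :+ (con (+ 1) :+ con (+ 1))) refl x
  W-recurrence (suc (suc j)) = solve 3 (λ x V₁ V₀ → (x :+ x) :* (((x :+ x) :* V₁ :+ :- V₀) :+ V₁)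
                                                 := (((x :+ x) :* ((x :+ x) :* V₁ :+ :- V₀) :+ :- V₁) :+ ((x :+ x) :* V₁ :+ :- V₀)) :+ (V₁ :+ V₀)) refl x (V x (suc j)) (V x j)

module QuotientRecurrence {c ℓ} (R : CommutativeRing c ℓ) where
  open Series R using (PS; mono; geo; invPoch)
  open PowerSeries R hiding (module ℙ)
  open CommutativeRing powerSeriesRing
  open IntegerCoefficients powerSeriesRing using (solve; _:=_; _:+_; _:*_; _:-_; 𝟙)
  open import Algebra.Properties.CommutativeSemigroup *-commutativeSemigroup using (xy∙z≈x∙zy; interchange)
  open import Relation.Binary.Reasoning.Setoid setoid

  -- invPochDiff n j = 1/(q²;q²)_(n-j), and 0 when j > n.
  invPochDiff : ℕ → ℕ → PS
  invPochDiff n       zero    = invPoch n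
  invPochDiff zero    (suc j) = 0#
  invPochDiff (suc n) (suc j) = invPochDiff n j

  invPochDiff-+ : ∀ d j → invPochDiff (d ℕ.+ j) j ≡ invPoch d
  invPochDiff-+ d zero    = ≡.cong invPoch (ℕP.+-identityʳ d)
  invPochDiff-+ d (suc j) = ≡.trans (≡.cong (λ n → invPochDiff n (suc j)) (ℕP.+-suc d j)) (invPochDiff-+ d j)

  invPochDiff-+-suc : ∀ d j → invPochDiff (d ℕ.+ j) (suc j) ≡ invPochDiff d 1
  invPochDiff-+-suc d zero    = ≡.cong (λ n → invPochDiff n 1) (ℕP.+-identityʳ d)
  invPochDiff-+-suc d (suc j) = ≡.trans (≡.cong (λ n → invPochDiff n (suc (suc j))) (ℕP.+-suc d j)) (invPochDiff-+-suc d j)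

  invPochDiff-1 : ∀ d → invPochDiff d 1 ≈ invPoch (suc d) * ((1-q²^ d) * (1-q²^ suc d))
  invPochDiff-1 zero    = sym (trans (*-congˡ (trans (*-congʳ 1-q²^0) (zeroˡ _))) (zeroʳ _))
  invPochDiff-1 (suc d) = begin
    invPoch d                                                      ≈⟨ invPoch-suc d ⟨
    invPoch (suc d) * 1-q²^ (suc d)                                ≈⟨ *-congʳ (invPoch-suc (suc d)) ⟨
    (invPoch (suc (suc d)) * 1-q²^ (suc (suc d))) * 1-q²^ (suc d)  ≈⟨ xy∙z≈x∙zy _ _ _ ⟩
    invPoch (suc (suc d)) * (1-q²^ (suc d) * 1-q²^ (suc (suc d)))  ∎

  -- G n j = q^(j²) / ((q²;q²)_(n-j) (q²;q²)_(n+j)), the coefficient of W j in the expansion.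
  G : ℕ → ℕ → PS
  G n j = mono (j ℕ.* j) * (invPochDiff n j * invPoch (n ℕ.+ j))

  G-beyond : ∀ n → G n (suc n) ≈ 0#
  G-beyond n = trans (*-congˡ (trans (*-congʳ (reflexive (invPochDiff-+-suc 0 n))) (zeroˡ _))) (zeroʳ _)

  -- The j = 0 coefficient receives c 1 twice, matching W₋ 1 = 2 W 0.
  before : (ℕ → PS) → ℕ → PS
  before c zero    = c 1
  before c (suc j) = c j

  q^[2n+1] q^[4n+2] : ℕ → PS
  q^[2n+1] n = mono (2 ℕ.* n ℕ.+ 1)
  q^[4n+2] n = mono (4 ℕ.* n ℕ.+ 2)

  O : ℕ → PS
  O n = 1-q²^ (suc (2 ℕ.* n)) * 1-q²^ (suc (suc (2 ℕ.* n)))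

  geo-pair : ℕ → PS
  geo-pair n = geo (suc (2 ℕ.* (2 ℕ.* n))) * geo (suc (2 ℕ.* suc (2 ℕ.* n)))

  O-inverse : ∀ n → O n * geo-pair n ≈ 1#
  O-inverse n = trans (interchange _ _ _ _) (trans (*-cong (1-q²^-inverse (2 ℕ.* n)) (1-q²^-inverse (suc (2 ℕ.* n)))) (*-identityˡ 1#))

  invPoch-2[n+1] : ∀ n → invPoch (2 ℕ.* suc n) ≈ invPoch (2 ℕ.* n) * geo-pair n
  invPoch-2[n+1] n = begin
    invPoch (2 ℕ.* suc n)                   ≈⟨ invPoch-cong (ℕP.*-suc 2 n) ⟩
    invPoch (suc (suc (2 ℕ.* n)))           ≈⟨ trans (invPoch-unfold (suc (2 ℕ.* n))) (*-congʳ (invPoch-unfold (2 ℕ.* n))) ⟩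
    invPoch (2 ℕ.* n) * geo (suc (2 ℕ.* (2 ℕ.* n))) * geo (suc (2 ℕ.* suc (2 ℕ.* n))) ≈⟨ *-assoc _ _ _ ⟩
    invPoch (2 ℕ.* n) * geo-pair n          ∎

  invPoch-n+n : ∀ n → invPoch (n ℕ.+ n) ≈ invPoch (suc n ℕ.+ suc n) * O n
  invPoch-n+n n = begin
    invPoch (n ℕ.+ n)
      ≈⟨ invPoch-split (n ℕ.+ n) (≡.cong suc n+n≡2n) ⟩
    invPoch (suc (2 ℕ.* n)) * 1-q²^ (suc (2 ℕ.* n))
      ≈⟨ *-congʳ (invPoch-split (suc (2 ℕ.* n)) ≡.refl) ⟩
    invPoch (suc (suc (2 ℕ.* n))) * 1-q²^ (suc (suc (2 ℕ.* n))) * 1-q²^ (suc (2 ℕ.* n))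
      ≈⟨ xy∙z≈x∙zy _ _ _ ⟩
    invPoch (suc (suc (2 ℕ.* n))) * O n
      ≈⟨ *-congʳ (invPoch-cong (≡.cong suc (≡.trans (≡.cong suc (≡.sym n+n≡2n)) (≡.sym (ℕP.+-suc n n))))) ⟩
    invPoch (suc n ℕ.+ suc n) * O n ∎
    where
    n+n≡2n : n ℕ.+ n ≡ 2 ℕ.* n
    n+n≡2n = ≡.cong (n ℕ.+_) (≡.sym (ℕP.+-identityʳ n))

  mono≈ : ∀ {k} e → k ≡ degree e → mono k ≈ ⟦ e ⟧ₘ
  mono≈ {k} e = monomial-≈ q^⟨ k ⟩ e

  module Recurrence (d i : ℕ) where
    j = suc i
    n = d ℕ.+ j
    p a b : Monomial
    p = q^⟨ 2 ⟩
    a = q^⟨ 2 ℕ.* d ⟩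
    b = q^⟨ 2 ℕ.* j ⟩
    P = ⟦ p ⟧ₘ
    A = ⟦ a ⟧ₘ
    B = ⟦ b ⟧ₘ
    s = mono (j ℕ.* j)
    I[d+1] = invPoch (suc d)
    I[n+j+1] = invPoch (suc (n ℕ.+ j))
    I[d] = I[d+1] * (1# - P * A)
    I[d-1] = I[d+1] * ((1# - A) * (1# - P * A))
    I[n+j] = I[n+j+1] * (1# - P * A * B * B)
    I[n+i] = I[n+j] * (1# - A * B * B)

    p·a : 2 ℕ.* suc d ≡ 2 ℕ.+ 2 ℕ.* d
    p·a = ℕSolver.solve (d ∷ [])
    a·b·b : 2 ℕ.* ((d ℕ.+ suc i) ℕ.+ suc i) ≡ 2 ℕ.* d ℕ.+ 2 ℕ.* suc i ℕ.+ 2 ℕ.* suc i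
    a·b·b = ℕSolver.solve (d ∷ i ∷ [])
    p·a·b·b : 2 ℕ.* suc ((d ℕ.+ suc i) ℕ.+ suc i) ≡ 2 ℕ.+ 2 ℕ.* d ℕ.+ 2 ℕ.* suc i ℕ.+ 2 ℕ.* suc i
    p·a·b·b = ℕSolver.solve (d ∷ i ∷ [])
    p·a·a·b·b : 4 ℕ.* (d ℕ.+ suc i) ℕ.+ 2 ≡ 2 ℕ.+ 2 ℕ.* d ℕ.+ 2 ℕ.* d ℕ.+ 2 ℕ.* suc i ℕ.+ 2 ℕ.* suc i
    p·a·a·b·b = ℕSolver.solve (d ∷ i ∷ [])
    p·a·a·b·b′ : 2 ℕ.* suc (2 ℕ.* (d ℕ.+ suc i)) ≡ 2 ℕ.+ 2 ℕ.* d ℕ.+ 2 ℕ.* d ℕ.+ 2 ℕ.* suc i ℕ.+ 2 ℕ.* suc i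
    p·a·a·b·b′ = ℕSolver.solve (d ∷ i ∷ [])
    p·p·a·a·b·b : 2 ℕ.* suc (suc (2 ℕ.* (d ℕ.+ suc i))) ≡ 2 ℕ.+ 2 ℕ.+ 2 ℕ.* d ℕ.+ 2 ℕ.* d ℕ.+ 2 ℕ.* suc i ℕ.+ 2 ℕ.* suc i
    p·p·a·a·b·b = ℕSolver.solve (d ∷ i ∷ [])
    s·p·a : (2 ℕ.* (d ℕ.+ suc i) ℕ.+ 1) ℕ.+ i ℕ.* i ≡ suc i ℕ.* suc i ℕ.+ (2 ℕ.+ 2 ℕ.* d)
    s·p·a = ℕSolver.solve (d ∷ i ∷ [])
    s·p·a·b·b : (2 ℕ.* (d ℕ.+ suc i) ℕ.+ 1) ℕ.+ suc (suc i) ℕ.* suc (suc i) ≡ suc i ℕ.* suc i ℕ.+ (2 ℕ.+ 2 ℕ.* d ℕ.+ 2 ℕ.* suc i ℕ.+ 2 ℕ.* suc i)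
    s·p·a·b·b = ℕSolver.solve (d ∷ i ∷ [])

    1-q²^[d+1] : 1-q²^ (suc d) ≈ 1# - P * A
    1-q²^[d+1] = +-congˡ (-‿cong (mono≈ (p ·ₘ a) p·a))

    invPoch-d : invPoch d ≈ I[d]
    invPoch-d = trans (invPoch-split d ≡.refl) (*-congˡ 1-q²^[d+1])

    invPoch-n+j : invPoch (n ℕ.+ j) ≈ I[n+j]
    invPoch-n+j = trans (invPoch-split (n ℕ.+ j) ≡.refl) (*-congˡ (+-congˡ (-‿cong (mono≈ (p ·ₘ a ·ₘ b ·ₘ b) p·a·b·b))))

    invPoch-n+i : invPoch (n ℕ.+ i) ≈ I[n+i]
    invPoch-n+i = trans (invPoch-split (n ℕ.+ i) (≡.sym (ℕP.+-suc n i))) (*-cong invPoch-n+j (+-congˡ (-‿cong (mono≈ (a ·ₘ b ·ₘ b) a·b·b))))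

    invPochDiff-n-i : invPochDiff n i ≡ I[d+1]
    invPochDiff-n-i = ≡.trans (≡.cong (λ m → invPochDiff m i) (ℕP.+-suc d i)) (invPochDiff-+ (suc d) i)

    invPochDiff-n-j+1 : invPochDiff n (suc j) ≈ I[d-1]
    invPochDiff-n-j+1 = trans (reflexive (invPochDiff-+-suc d j)) (trans (invPochDiff-1 d) (*-congˡ (*-congˡ 1-q²^[d+1])))

    G-n-j : G n j ≈ s * (I[d] * I[n+j])
    G-n-j = *-congˡ (*-cong (trans (reflexive (invPochDiff-+ d j)) invPoch-d) invPoch-n+j)

    q^[2n+1]-G-n-i : q^[2n+1] n * G n i ≈ (s * (P * A)) * (I[d+1] * I[n+i])
    q^[2n+1]-G-n-i = trans (sym (*-assoc _ _ _))
      (*-cong (monomial-≈ (q^⟨ 2 ℕ.* n ℕ.+ 1 ⟩ ·ₘ q^⟨ i ℕ.* i ⟩) (q^⟨ j ℕ.* j ⟩ ·ₘ (p ·ₘ a)) s·p·a)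
              (*-cong (reflexive invPochDiff-n-i) invPoch-n+i))

    q^[2n+1]-G-n-j+1 : q^[2n+1] n * G n (suc j) ≈ (s * (P * A * B * B)) * (I[d-1] * I[n+j+1])
    q^[2n+1]-G-n-j+1 = trans (sym (*-assoc _ _ _))
      (*-cong (monomial-≈ (q^⟨ 2 ℕ.* n ℕ.+ 1 ⟩ ·ₘ q^⟨ suc j ℕ.* suc j ⟩) (q^⟨ j ℕ.* j ⟩ ·ₘ (p ·ₘ a ·ₘ b ·ₘ b)) s·p·a·b·b)
              (*-cong invPochDiff-n-j+1 (invPoch-cong (ℕP.+-suc n j))))

    G-suc-n-j-O : G (suc n) j * O n ≈ (s * (I[d+1] * I[n+j+1])) * ((1# - P * A * A * B * B) * (1# - P * P * A * A * B * B))
    G-suc-n-j-O = *-cong (*-congˡ (*-congʳ (reflexive (invPochDiff-+ (suc d) j))))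
                         (*-cong (+-congˡ (-‿cong (mono≈ (p ·ₘ a ·ₘ a ·ₘ b ·ₘ b) p·a·a·b·b′)))
                                 (+-congˡ (-‿cong (mono≈ (p ·ₘ p ·ₘ a ·ₘ a ·ₘ b ·ₘ b) p·p·a·a·b·b))))

    recurrence : (1# + q^[4n+2] n) * G n j + q^[2n+1] n * (G n i + G n (suc j)) ≈ G (suc n) j * O n
    recurrence = begin
      (1# + q^[4n+2] n) * G n j + q^[2n+1] n * (G n i + G n (suc j))
        ≈⟨ +-cong (*-cong (+-congˡ (mono≈ (p ·ₘ a ·ₘ a ·ₘ b ·ₘ b) p·a·a·b·b)) G-n-j)
                  (trans (distribˡ _ _ _) (+-cong q^[2n+1]-G-n-i q^[2n+1]-G-n-j+1)) ⟩
      (1# + P * A * A * B * B) * (s * (I[d] * I[n+j])) + ((s * (P * A)) * (I[d+1] * I[n+i]) + (s * (P * A * B * B)) * (I[d-1] * I[n+j+1]))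
        ≈⟨ solve 6 (λ P A B Y Z s →
             (𝟙 :+ P :* A :* A :* B :* B) :* (s :* ((Y :* (𝟙 :- P :* A)) :* (Z :* (𝟙 :- P :* A :* B :* B))))
             :+ ((s :* (P :* A)) :* (Y :* ((Z :* (𝟙 :- P :* A :* B :* B)) :* (𝟙 :- A :* B :* B)))
                 :+ (s :* (P :* A :* B :* B)) :* ((Y :* ((𝟙 :- A) :* (𝟙 :- P :* A))) :* Z))
             := (s :* (Y :* Z)) :* ((𝟙 :- P :* A :* A :* B :* B) :* (𝟙 :- P :* P :* A :* A :* B :* B)))
             refl P A B I[d+1] I[n+j+1] s ⟩
      (s * (I[d+1] * I[n+j+1])) * ((1# - P * A * A * B * B) * (1# - P * P * A * A * B * B))
        ≈⟨ G-suc-n-j-O ⟨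
      G (suc n) j * O n ∎

  module Recurrence₀ (d : ℕ) where
    p a : Monomial
    p = q^⟨ 2 ⟩
    a = q^⟨ 2 ℕ.* d ⟩
    P = ⟦ p ⟧ₘ
    A = ⟦ a ⟧ₘ
    I[d+1] = invPoch (suc d)
    I[d] = I[d+1] * (1# - P * A)
    I[d-1] = I[d+1] * ((1# - A) * (1# - P * A))

    p·a : 2 ℕ.* suc d ≡ 2 ℕ.+ 2 ℕ.* d
    p·a = ℕSolver.solve (d ∷ [])
    p·a′ : (2 ℕ.* d ℕ.+ 1) ℕ.+ 1 ≡ 2 ℕ.+ 2 ℕ.* d
    p·a′ = ℕSolver.solve (d ∷ [])
    p·a·a : 4 ℕ.* d ℕ.+ 2 ≡ 2 ℕ.+ 2 ℕ.* d ℕ.+ 2 ℕ.* d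
    p·a·a = ℕSolver.solve (d ∷ [])
    p·a·a′ : 2 ℕ.* suc (2 ℕ.* d) ≡ 2 ℕ.+ 2 ℕ.* d ℕ.+ 2 ℕ.* d
    p·a·a′ = ℕSolver.solve (d ∷ [])
    p·p·a·a : 2 ℕ.* suc (suc (2 ℕ.* d)) ≡ 2 ℕ.+ 2 ℕ.+ 2 ℕ.* d ℕ.+ 2 ℕ.* d
    p·p·a·a = ℕSolver.solve (d ∷ [])

    1-q²^[d+1] : 1-q²^ (suc d) ≈ 1# - P * A
    1-q²^[d+1] = +-congˡ (-‿cong (mono≈ (p ·ₘ a) p·a))

    invPoch-d : invPoch d ≈ I[d]
    invPoch-d = trans (invPoch-split d ≡.refl) (*-congˡ 1-q²^[d+1])

    G-d-0 : G d 0 ≈ 1# * (I[d] * I[d])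
    G-d-0 = *-cong mono-0 (*-cong invPoch-d (trans (invPoch-cong (ℕP.+-identityʳ d)) invPoch-d))

    q^[2d+1]-G-d-1 : q^[2n+1] d * G d 1 ≈ (P * A) * (I[d-1] * I[d+1])
    q^[2d+1]-G-d-1 = trans (sym (*-assoc _ _ _))
      (*-cong (monomial-≈ (q^⟨ 2 ℕ.* d ℕ.+ 1 ⟩ ·ₘ q^⟨ 1 ⟩) (p ·ₘ a) p·a′)
              (*-cong (trans (invPochDiff-1 d) (*-congˡ (*-congˡ 1-q²^[d+1]))) (invPoch-cong (ℕP.+-comm d 1))))

    G-suc-d-0-O : G (suc d) 0 * O d ≈ (1# * (I[d+1] * I[d+1])) * ((1# - P * A * A) * (1# - P * P * A * A))
    G-suc-d-0-O = *-cong (*-cong mono-0 (*-congˡ (invPoch-cong (ℕP.+-identityʳ (suc d)))))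
                         (*-cong (+-congˡ (-‿cong (mono≈ (p ·ₘ a ·ₘ a) p·a·a′)))
                                 (+-congˡ (-‿cong (mono≈ (p ·ₘ p ·ₘ a ·ₘ a) p·p·a·a))))

    recurrence : (1# + q^[4n+2] d) * G d 0 + q^[2n+1] d * (G d 1 + G d 1) ≈ G (suc d) 0 * O d
    recurrence = begin
      (1# + q^[4n+2] d) * G d 0 + q^[2n+1] d * (G d 1 + G d 1)
        ≈⟨ +-cong (*-cong (+-congˡ (mono≈ (p ·ₘ a ·ₘ a) p·a·a)) G-d-0) (trans (distribˡ _ _ _) (+-cong q^[2d+1]-G-d-1 q^[2d+1]-G-d-1)) ⟩
      (1# + P * A * A) * (1# * (I[d] * I[d])) + ((P * A) * (I[d-1] * I[d+1]) + (P * A) * (I[d-1] * I[d+1]))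
        ≈⟨ solve 3 (λ P A Y →
             (𝟙 :+ P :* A :* A) :* (𝟙 :* ((Y :* (𝟙 :- P :* A)) :* (Y :* (𝟙 :- P :* A))))
             :+ ((P :* A) :* ((Y :* ((𝟙 :- A) :* (𝟙 :- P :* A))) :* Y) :+ (P :* A) :* ((Y :* ((𝟙 :- A) :* (𝟙 :- P :* A))) :* Y))
             := (𝟙 :* (Y :* Y)) :* ((𝟙 :- P :* A :* A) :* (𝟙 :- P :* P :* A :* A))) refl P A I[d+1] ⟩
      (1# * (I[d+1] * I[d+1])) * ((1# - P * A * A) * (1# - P * P * A * A))
        ≈⟨ G-suc-d-0-O ⟨
      G (suc d) 0 * O d ∎

  G-recurrence : ∀ n j → j ≤ n → (1# + q^[4n+2] n) * G n j + q^[2n+1] n * (before (G n) j + G n (suc j)) ≈ G (suc n) j * O n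
  G-recurrence n zero    _     = Recurrence₀.recurrence n
  G-recurrence n (suc i) i+1≤n = ≡.subst (λ m → (1# + q^[4n+2] m) * G m (suc i) + q^[2n+1] m * (G m i + G m (suc (suc i))) ≈ G (suc m) (suc i) * O m)
                                         (ℕP.m∸n+n≡m i+1≤n) (Recurrence.recurrence (n ∸ suc i) i)

  G-top : ∀ n → q^[2n+1] n * G n n ≈ G (suc n) (suc n) * O n
  G-top n = begin
    q^[2n+1] n * (mono (n ℕ.* n) * (invPochDiff n n * invPoch (n ℕ.+ n)))
      ≈⟨ *-assoc _ _ _ ⟨
    (q^[2n+1] n * mono (n ℕ.* n)) * (invPochDiff n n * invPoch (n ℕ.+ n))
      ≈⟨ *-cong (monomial-≈ (q^⟨ 2 ℕ.* n ℕ.+ 1 ⟩ ·ₘ q^⟨ n ℕ.* n ⟩) q^⟨ suc n ℕ.* suc n ⟩ square) (*-congˡ (invPoch-n+n n)) ⟩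
    mono (suc n ℕ.* suc n) * (invPochDiff n n * (invPoch (suc n ℕ.+ suc n) * O n))
      ≈⟨ *-congˡ (sym (*-assoc _ _ _)) ⟩
    mono (suc n ℕ.* suc n) * (invPochDiff n n * invPoch (suc n ℕ.+ suc n) * O n)
      ≈⟨ *-assoc _ _ _ ⟨
    G (suc n) (suc n) * O n ∎
    where
    square : (2 ℕ.* n ℕ.+ 1) ℕ.+ n ℕ.* n ≡ suc n ℕ.* suc n
    square = ℕSolver.solve (n ∷ [])


module ProductExpansion {c ℓ} (R : CommutativeRing c ℓ) (x : CommutativeRing.Carrier R) where
  open Series R using (PS; mono; _·_; prodPS; invPoch)
  open PowerSeries R hiding (module ℙ)
  open CommutativeRing powerSeriesRing
  open IntegerCoefficients powerSeriesRing using (solve; _:=_; _:+_; _:*_; _:-_; 𝟘; 𝟙)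
  open Chebyshev R x using (W; W₋; W-recurrence)
  open QuotientRecurrence R
  open import Algebra.Properties.CommutativeSemigroup *-commutativeSemigroup using (interchange)
  open import Relation.Binary.Reasoning.Setoid setoid
  module Coeff = CommutativeRing R
  module Σₚ = Series powerSeriesRing
  module Σₚ-Props = FiniteSums powerSeriesRing

  const-W-recurrence : ∀ j → const ((x Coeff.+ x) Coeff.* W j) ≈ const (W (suc j)) + const (W₋ j)
  const-W-recurrence j = trans (const-cong (W-recurrence j)) (const-+ _ _)

  const-W0 : const (W 0) ≈ 1#
  const-W0 = trans (const-cong (Coeff.+-identityʳ Coeff.1#)) const-1

  Σ-W-recurrence : ∀ M (c : ℕ → PS) →
    Σₚ.Σ≤ M (λ j → const ((x Coeff.+ x) Coeff.* W j) * c j)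
      ≈ Σₚ.Σ≤ M (λ j → const (W j) * (before c j + c (suc j))) + const (W (suc M)) * c M - const (W₋ (suc M)) * c (suc M)
  Σ-W-recurrence zero c = begin
    0# + const ((x Coeff.+ x) Coeff.* W 0) * c 0
      ≈⟨ +-congˡ (*-congʳ (trans (const-W-recurrence 0) (+-congˡ const-0))) ⟩
    0# + (const (W 1) + 0#) * c 0
      ≈⟨ solve 3 (λ W₁ c₀ c₁ → 𝟘 :+ (W₁ :+ 𝟘) :* c₀ := (𝟘 :+ 𝟙 :* (c₁ :+ c₁)) :+ W₁ :* c₀ :- (𝟙 :+ 𝟙) :* c₁) refl (const (W 1)) (c 0) (c 1) ⟩
    (0# + 1# * (c 1 + c 1)) + const (W 1) * c 0 - (1# + 1#) * c 1
      ≈⟨ +-cong (+-congʳ (+-congˡ (*-congʳ const-W0))) (-‿cong (*-congʳ (trans (const-+ _ _) (+-cong const-1 const-1)))) ⟨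
    (0# + const (W 0) * (c 1 + c 1)) + const (W 1) * c 0 - const (W₋ 1) * c 1 ∎
  Σ-W-recurrence (suc M) c = begin
    Σₚ.Σ≤ M f + const ((x Coeff.+ x) Coeff.* W (suc M)) * c (suc M)
      ≈⟨ +-cong (Σ-W-recurrence M c) (*-congʳ (const-W-recurrence (suc M))) ⟩
    (S + w₁ * c M - w₋ * c (suc M)) + (w₂ + w₋) * c (suc M)
      ≈⟨ solve 7 (λ S w₁ w₂ w₋ c₀ c₁ c₂ → (S :+ w₁ :* c₀ :- w₋ :* c₁) :+ (w₂ :+ w₋) :* c₁
                                         := S :+ w₁ :* (c₀ :+ c₂) :+ w₂ :* c₁ :- w₁ :* c₂) refl S w₁ w₂ w₋ (c M) (c (suc M)) (c (suc (suc M))) ⟩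
    S + w₁ * (c M + c (suc (suc M))) + w₂ * c (suc M) - w₁ * c (suc (suc M)) ∎
    where
    f = λ j → const ((x Coeff.+ x) Coeff.* W j) * c j
    S = Σₚ.Σ≤ M (λ j → const (W j) * (before c j + c (suc j)))
    w₁ = const (W (suc M))
    w₂ = const (W (suc (suc M)))
    w₋ = const (W₋ (suc M))

  factor : ℕ → PS
  factor k = 1# + (x Coeff.+ x) · mono (2 ℕ.* k ℕ.+ 1) + mono (4 ℕ.* k ℕ.+ 2)

  factor≈ : ∀ n → factor n ≈ (1# + q^[4n+2] n) + const (x Coeff.+ x) * q^[2n+1] n
  factor≈ n = trans (+-congʳ (+-congˡ (·≈const-⊛ (x Coeff.+ x) (q^[2n+1] n))))
                    (solve 2 (λ c v → (𝟙 :+ c) :+ v := (𝟙 :+ v) :+ c) refl (const (x Coeff.+ x) * q^[2n+1] n) (q^[4n+2] n))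

  WG : ℕ → ℕ → PS
  WG n j = const (W j) * G n j

  G-three-term : ℕ → ℕ → PS
  G-three-term n j = (1# + q^[4n+2] n) * G n j + q^[2n+1] n * (before (G n) j + G n (suc j))

  before-distrib : ∀ u c j → before (λ k → u * c k) j + u * c (suc j) ≈ u * (before c j + c (suc j))
  before-distrib u c zero    = sym (distribˡ u (c 1) (c 1))
  before-distrib u c (suc j) = sym (distribˡ u (c j) (c (suc (suc j))))

  expansion-regroup : ∀ n → Σₚ.Σ≤ n (WG n) * factor n ≈ Σₚ.Σ≤ n (λ j → const (W j) * G-three-term n j) + const (W (suc n)) * (q^[2n+1] n * G n n)
  expansion-regroup n = begin
    Σₚ.Σ≤ n (WG n) * factor n
      ≈⟨ trans (*-congˡ (factor≈ n)) (Σₚ-Props.*-distribʳ-Σ (suc n) _ _) ⟩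
    Σₚ.Σ≤ n (λ j → WG n j * ((1# + U²) + c₂ₓ * U))
      ≈⟨ trans (Σₚ-Props.Σ-cong (suc n) split) (Σₚ-Props.Σ-distrib-+ (suc n) _ _) ⟩
    Σ₁ + Σₚ.Σ≤ n (λ j → const ((x Coeff.+ x) Coeff.* W j) * (U * G n j))
      ≈⟨ +-congˡ (Σ-W-recurrence n (λ j → U * G n j)) ⟩
    Σ₁ + (Σₚ.Σ≤ n (λ j → const (W j) * (before (λ k → U * G n k) j + U * G n (suc j))) + w * (U * G n n) - w₋ * (U * G n (suc n)))
      ≈⟨ +-congˡ (+-cong (+-congʳ (Σₚ-Props.Σ-cong (suc n) (λ j → *-congˡ (before-distrib U (G n) j))))
                         (-‿cong (*-congˡ (trans (*-congˡ (G-beyond n)) (zeroʳ U))))) ⟩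
    Σ₁ + (Σ₂ + w * (U * G n n) - w₋ * 0#)
      ≈⟨ solve 4 (λ a b c w₋ → a :+ (b :+ c :- w₋ :* 𝟘) := a :+ b :+ c) refl Σ₁ Σ₂ (w * (U * G n n)) w₋ ⟩
    Σ₁ + Σ₂ + w * (U * G n n)
      ≈⟨ +-congʳ (trans (sym (Σₚ-Props.Σ-distrib-+ (suc n) _ _)) (Σₚ-Props.Σ-cong (suc n) (λ j → sym (distribˡ _ _ _)))) ⟩
    Σₚ.Σ≤ n (λ j → const (W j) * G-three-term n j) + w * (U * G n n) ∎
    where
    U = q^[2n+1] n
    U² = q^[4n+2] n
    c₂ₓ = const (x Coeff.+ x)
    w = const (W (suc n))
    w₋ = const (W₋ (suc n))
    Σ₁ = Σₚ.Σ≤ n (λ j → const (W j) * ((1# + U²) * G n j))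
    Σ₂ = Σₚ.Σ≤ n (λ j → const (W j) * (U * (before (G n) j + G n (suc j))))
    split : ∀ j → WG n j * ((1# + U²) + c₂ₓ * U) ≈ const (W j) * ((1# + U²) * G n j) + const ((x Coeff.+ x) Coeff.* W j) * (U * G n j)
    split j = trans (solve 5 (λ w g a c u → (w :* g) :* (a :+ c :* u) := w :* (a :* g) :+ (c :* w) :* (u :* g)) refl (const (W j)) (G n j) (1# + U²) c₂ₓ U)
                    (+-congˡ (*-congʳ (sym (const-* _ _))))

  expansion-step : ∀ n → Σₚ.Σ≤ n (WG n) * factor n ≈ Σₚ.Σ≤ (suc n) (WG (suc n)) * O n
  expansion-step n = begin
    Σₚ.Σ≤ n (WG n) * factor n
      ≈⟨ expansion-regroup n ⟩
    Σₚ.Σ≤ n (λ j → const (W j) * G-three-term n j) + const (W (suc n)) * (q^[2n+1] n * G n n)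
      ≈⟨ +-cong (Σₚ-Props.Σ-cong-< (suc n) (λ j j<n+1 → *-congˡ (G-recurrence n j (ℕP.≤-pred j<n+1)))) (*-congˡ (G-top n)) ⟩
    Σₚ.Σ≤ n (λ j → const (W j) * (G (suc n) j * O n)) + const (W (suc n)) * (G (suc n) (suc n) * O n)
      ≈⟨ +-cong (Σₚ-Props.Σ-cong (suc n) (λ j → sym (*-assoc _ _ _))) (sym (*-assoc _ _ _)) ⟩
    Σₚ.Σ≤ n (λ j → WG (suc n) j * O n) + WG (suc n) (suc n) * O n
      ≈⟨ +-congʳ (Σₚ-Props.*-distribʳ-Σ (suc n) (O n) (WG (suc n))) ⟨
    Σₚ.Σ≤ n (WG (suc n)) * O n + WG (suc n) (suc n) * O n
      ≈⟨ distribʳ _ _ _ ⟨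
    Σₚ.Σ≤ (suc n) (WG (suc n)) * O n ∎

  product-expansion : ∀ n → prodPS n factor * invPoch (2 ℕ.* n) ≈ Σₚ.Σ≤ n (WG n)
  product-expansion zero = trans (*-identityˡ 1#)
    (sym (trans (+-identityˡ _) (trans (*-cong const-W0 (trans (*-cong mono-0 (*-identityˡ 1#)) (*-identityˡ 1#))) (*-identityˡ 1#))))
  product-expansion (suc n) = begin
    prodPS (suc n) factor * invPoch (2 ℕ.* suc n)
      ≈⟨ *-cong (sym (⊛≈⊗ (prodPS n factor) (factor n))) (invPoch-2[n+1] n) ⟩
    (prodPS n factor * factor n) * (invPoch (2 ℕ.* n) * geo-pair n)
      ≈⟨ interchange _ _ _ _ ⟩
    (prodPS n factor * invPoch (2 ℕ.* n)) * (factor n * geo-pair n)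
      ≈⟨ trans (*-congʳ (product-expansion n)) (sym (*-assoc _ _ _)) ⟩
    (Σₚ.Σ≤ n (WG n) * factor n) * geo-pair n
      ≈⟨ trans (*-congʳ (expansion-step n)) (*-assoc _ _ _) ⟩
    Σₚ.Σ≤ (suc n) (WG (suc n)) * (O n * geo-pair n)
      ≈⟨ trans (*-congˡ (O-inverse n)) (*-identityʳ _) ⟩
    Σₚ.Σ≤ (suc n) (WG (suc n)) ∎

rhsExponent : ℕ → ℕ
rhsExponent n = 4 ℕ.* n ℕ.* n ∸ 2 ℕ.* n

rhsExponent-suc : ∀ i → rhsExponent (suc i) ≡ 4 ℕ.* i ℕ.* i ℕ.+ 6 ℕ.* i ℕ.+ 2
rhsExponent-suc i = ≡.trans (≡.cong (_∸ 2 ℕ.* suc i) expand) (ℕP.m+n∸n≡m _ (2 ℕ.* suc i))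
  where
  expand : 4 ℕ.* suc i ℕ.* suc i ≡ 4 ℕ.* i ℕ.* i ℕ.+ 6 ℕ.* i ℕ.+ 2 ℕ.+ 2 ℕ.* suc i
  expand = ℕSolver.solve (i ∷ [])

n≤n*n : ∀ n → n ≤ n ℕ.* n
n≤n*n zero    = z≤n
n≤n*n (suc m) = ℕP.m≤m*n (suc m) (suc m)

j*j+n≤rhsExponent : ∀ {j n} → j ≤ n → j ℕ.* j ℕ.+ n ≤ rhsExponent n
j*j+n≤rhsExponent {j} {n} j≤n = ℕP.m+n≤o⇒m≤o∸n (j ℕ.* j ℕ.+ n) (begin
  j ℕ.* j ℕ.+ n ℕ.+ 2 ℕ.* n        ≤⟨ ℕP.+-monoˡ-≤ (2 ℕ.* n) (ℕP.+-monoˡ-≤ n (ℕP.*-mono-≤ j≤n j≤n)) ⟩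
  n ℕ.* n ℕ.+ n ℕ.+ 2 ℕ.* n        ≡⟨ ℕSolver.solve (n ∷ []) ⟩
  n ℕ.* n ℕ.+ 3 ℕ.* n              ≤⟨ ℕP.+-monoʳ-≤ (n ℕ.* n) (ℕP.*-monoʳ-≤ 3 (n≤n*n n)) ⟩
  n ℕ.* n ℕ.+ 3 ℕ.* (n ℕ.* n)      ≡⟨ ℕSolver.solve (n ∷ []) ⟩
  4 ℕ.* n ℕ.* n                    ∎)
  where open ℕP.≤-Reasoning

k+j≤rhsExponent∸j*j : ∀ k j → k ℕ.+ j ≤ rhsExponent (k ℕ.+ j) ∸ j ℕ.* j
k+j≤rhsExponent∸j*j k j = ℕP.m+n≤o⇒m≤o∸n (k ℕ.+ j)
  (≡.subst (_≤ rhsExponent (k ℕ.+ j)) (ℕP.+-comm (j ℕ.* j) (k ℕ.+ j)) (j*j+n≤rhsExponent (ℕP.m≤n+m j k)))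

module CoefficientIdentity {c ℓ} (R : CommutativeRing c ℓ) where
  open Series R using (PS; mono; tsum; invPoch; invPochInf)
  open PowerSeries R hiding (module ℙ)
  open InfiniteSums R
  open CauchyIdentity R using (t; D; t-summable; D-rec-b; cauchy)
  open QuotientRecurrence R using (invPochDiff; invPochDiff-+; G)
  open CommutativeRing powerSeriesRing
  open IntegerCoefficients powerSeriesRing using (solve; _:=_; _:+_; _:*_; :-_; _:-_; 𝟙)
  open import Algebra.Properties.CommutativeSemigroup *-commutativeSemigroup using (x∙yz≈y∙xz)
  open import Relation.Binary.Reasoning.Setoid setoid

  I : PS
  I = invPochInf

  -- With n = m + 1, the n-th summand of the left-hand side is M m · Σ_j W_j G n j.
  M : ℕ → PS
  M m = mono (2 ℕ.* m ℕ.* m ℕ.+ 2 ℕ.* m) * 1-q²^ (2 ℕ.* suc m)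

  T : ℕ → ℕ → PS
  T m j = M m * G (suc m) j

  Ord≥-T : ∀ m j → Ord≥ m (T m j)
  Ord≥-T m j = Ord≥-⊛ˡ m (Ord≥-mono-⊛ (2 ℕ.* m ℕ.* m ℕ.+ 2 ℕ.* m) (ℕP.≤-trans (ℕP.m≤m+n m (m ℕ.+ 0)) (ℕP.m≤n+m (2 ℕ.* m) (2 ℕ.* m ℕ.* m))))

  -- The coefficient of W j collects the summands m ≥ j - 1.
  𝓛-terms : ℕ → ℕ → PS
  𝓛-terms zero    k = T k 0
  𝓛-terms (suc i) k = T (k ℕ.+ i) (suc i)

  𝓛-summable : ∀ j → Summable (𝓛-terms j)
  𝓛-summable zero    k = Ord≥-T k 0
  𝓛-summable (suc i) k = Ord≥-weaken (ℕP.m≤m+n k i) (Ord≥-T (k ℕ.+ i) (suc i))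

  𝓛 : ℕ → PS
  𝓛 j = tsum (𝓛-terms j)

  Ord≥-𝓛 : ∀ j → Ord≥ j (𝓛 j)
  Ord≥-𝓛 zero    = Ord≥-0
  Ord≥-𝓛 (suc i) = Ord≥-tsum (suc i) _ (λ k → Ord≥-⊛ʳ (suc i) (Ord≥-mono-⊛ (suc i ℕ.* suc i) (n≤n*n (suc i))))

  𝓡-terms : ℕ → ℕ → PS
  𝓡-terms j k = 1-q^ (12 ℕ.* (k ℕ.+ j) ℕ.+ 6) * mono (rhsExponent (k ℕ.+ j) ∸ j ℕ.* j)

  Ord≥-𝓡-terms : ∀ j k → Ord≥ (k ℕ.+ j) (𝓡-terms j k)
  Ord≥-𝓡-terms j k = Ord≥-⊛ʳ (k ℕ.+ j) (Ord≥-weaken (k+j≤rhsExponent∸j*j k j) (Ord≥-mono _))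

  𝓡-summable : ∀ j → Summable (𝓡-terms j)
  𝓡-summable j k = Ord≥-weaken (ℕP.m≤m+n k j) (Ord≥-𝓡-terms j k)

  𝓡 : ℕ → PS
  𝓡 j = tsum (𝓡-terms j)

  Ord≥-𝓡 : ∀ j → Ord≥ j (𝓡 j)
  Ord≥-𝓡 j = Ord≥-tsum j _ (λ k → Ord≥-weaken (ℕP.m≤n+m j k) (Ord≥-𝓡-terms j k))

  tail-term : ℕ → PS
  tail-term n = 1-q^ (12 ℕ.* n ℕ.+ 6) * mono (rhsExponent n)

  tail : ℕ → PS
  tail j = tsum (λ k → tail-term (k ℕ.+ j))

  n≤rhsExponent : ∀ n → n ≤ rhsExponent n
  n≤rhsExponent n = j*j+n≤rhsExponent {0} z≤n

  Ord≥-tail-term : ∀ n → Ord≥ n (tail-term n)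
  Ord≥-tail-term n = Ord≥-⊛ʳ n (Ord≥-weaken (n≤rhsExponent n) (Ord≥-mono (rhsExponent n)))

  tail-step : ∀ j → tail j ≈ tail-term j + tail (suc j)
  tail-step j = trans (tsum-head _ (λ k → Ord≥-weaken (ℕP.m≤m+n k j) (Ord≥-tail-term (k ℕ.+ j))))
                      (+-congˡ (tsum-cong (λ k → reflexive (≡.cong tail-term (≡.sym (ℕP.+-suc k j))))))

  Ord≥-tail : ∀ j → Ord≥ j (tail j)
  Ord≥-tail j = Ord≥-tsum j _ (λ k → Ord≥-weaken (ℕP.m≤n+m j k) (Ord≥-tail-term (k ℕ.+ j)))

  q^j²-𝓡 : ∀ j → mono (j ℕ.* j) * 𝓡 j ≈ tail j
  q^j²-𝓡 j = trans (⊛-distribˡ-tsum _ _ (𝓡-summable j)) (tsum-cong term)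
    where
    term : ∀ k → mono (j ℕ.* j) * 𝓡-terms j k ≈ tail-term (k ℕ.+ j)
    term k = trans (x∙yz≈y∙xz _ _ _) (*-congˡ (trans (mono-+ (j ℕ.* j) _)
               (mono-cong (ℕP.m+[n∸m]≡n (ℕP.m+n≤o⇒m≤o (j ℕ.* j) (j*j+n≤rhsExponent (ℕP.m≤n+m j k)))))))

  Λ : ℕ → PS
  Λ j = mono (j ℕ.* j) * 𝓛 j

  Ord≥-Λ : ∀ j → Ord≥ j (Λ j)
  Ord≥-Λ j = Ord≥-mono-⊛ (j ℕ.* j) (n≤n*n j)

  difference⇒step : ∀ {a b c} → a - b ≈ c → a ≈ c + b
  difference⇒step {a} {b} a-b≈c = trans (solve 2 (λ a b → a := (a :- b) :+ b) refl a b) (+-congʳ a-b≈c)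

  module Step₀ (k : ℕ) where
    q = mono 1
    P₁ = q²^ (k ℕ.* k ℕ.+ 1 ℕ.* k)
    X = q²^ (suc k)
    A = invPoch (suc (suc k))
    I[k+1] = A * (1# - q * q * X)
    I[k] = I[k+1] * (1# - X)

    q·q·X : 2 ℕ.* suc (suc k) ≡ 1 ℕ.+ 1 ℕ.+ 2 ℕ.* suc k
    q·q·X = ℕSolver.solve (k ∷ [])
    X·X : 2 ℕ.* (2 ℕ.* suc k) ≡ 2 ℕ.* suc k ℕ.+ 2 ℕ.* suc k
    X·X = ℕSolver.solve (k ∷ [])
    M-exponent : 2 ℕ.* k ℕ.* k ℕ.+ 2 ℕ.* k ≡ 2 ℕ.* (k ℕ.* k ℕ.+ 1 ℕ.* k)
    M-exponent = ℕSolver.solve (k ∷ [])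
    p·X : 1 ℕ.+ (k ℕ.* k ℕ.+ 2 ℕ.* k) ≡ (k ℕ.* k ℕ.+ 1 ℕ.* k) ℕ.+ suc k
    p·X = ℕSolver.solve (k ∷ [])

    invPoch-k+1 : invPoch (suc k) ≈ I[k+1]
    invPoch-k+1 = trans (invPoch-split (suc k) ≡.refl)
      (*-congˡ (+-congˡ (-‿cong (monomial-≈ q^⟨ 2 ℕ.* suc (suc k) ⟩ (q^⟨ 1 ⟩ ·ₘ q^⟨ 1 ⟩ ·ₘ q^⟨ 2 ℕ.* suc k ⟩) q·q·X))))

    invPoch-k : invPoch k ≈ I[k]
    invPoch-k = trans (invPoch-split k ≡.refl) (*-congʳ invPoch-k+1)

    M-k : M k ≈ P₁ * (1# - X * X)
    M-k = *-cong (mono-cong M-exponent) (+-congˡ (-‿cong (monomial-≈ q^⟨ 2 ℕ.* (2 ℕ.* suc k) ⟩ (q^⟨ 2 ℕ.* suc k ⟩ ·ₘ q^⟨ 2 ℕ.* suc k ⟩) X·X)))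

    T-k-0 : T k 0 ≈ (P₁ * (1# - X * X)) * (1# * (I[k+1] * I[k+1]))
    T-k-0 = *-cong M-k (*-cong mono-0 (*-cong invPoch-k+1 (trans (invPoch-cong (ℕP.+-identityʳ (suc k))) invPoch-k+1)))

    T-k-1 : T (k ℕ.+ 0) 1 ≈ (P₁ * (1# - X * X)) * (q * (I[k] * A))
    T-k-1 = trans (reflexive (≡.cong (λ m → T m 1) (ℕP.+-identityʳ k)))
                  (*-cong M-k (*-congˡ (*-cong invPoch-k (invPoch-cong (ℕP.+-comm (suc k) 1)))))

    t-2-1 : t 2 1 k ≈ P₁ * (I[k] * A)
    t-2-1 = *-congˡ (*-cong invPoch-k (invPoch-cong (ℕP.+-comm k 2)))

    p·t-2-2 : q²^ 1 * t 2 2 k ≈ (P₁ * X) * (I[k] * A)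
    p·t-2-2 = trans (sym (*-assoc _ _ _))
      (*-cong (q²^-regroup 1 (k ℕ.* k ℕ.+ 2 ℕ.* k) (k ℕ.* k ℕ.+ 1 ℕ.* k) (suc k) p·X) (*-cong invPoch-k (invPoch-cong (ℕP.+-comm k 2))))

    difference : mono 0 * T k 0 - mono 1 * T (k ℕ.+ 0) 1 ≈ 1-q²^ 1 * (t 2 1 k + q²^ 1 * t 2 2 k)
    difference = begin
      mono 0 * T k 0 - q * T (k ℕ.+ 0) 1
        ≈⟨ +-cong (*-cong mono-0 T-k-0) (-‿cong (*-congˡ T-k-1)) ⟩
      1# * ((P₁ * (1# - X * X)) * (1# * (I[k+1] * I[k+1]))) - q * ((P₁ * (1# - X * X)) * (q * (I[k] * A)))
        ≈⟨ solve 4 (λ q P₁ X A →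
             𝟙 :* ((P₁ :* (𝟙 :- X :* X)) :* (𝟙 :* ((A :* (𝟙 :- q :* q :* X)) :* (A :* (𝟙 :- q :* q :* X)))))
             :- q :* ((P₁ :* (𝟙 :- X :* X)) :* (q :* (((A :* (𝟙 :- q :* q :* X)) :* (𝟙 :- X)) :* A)))
             := (𝟙 :- q :* q) :* (P₁ :* (((A :* (𝟙 :- q :* q :* X)) :* (𝟙 :- X)) :* A) :+ (P₁ :* X) :* (((A :* (𝟙 :- q :* q :* X)) :* (𝟙 :- X)) :* A)))
             refl q P₁ X A ⟩
      (1# - q * q) * (P₁ * (I[k] * A) + (P₁ * X) * (I[k] * A))
        ≈⟨ *-cong (+-congˡ (-‿cong (mono-+ 1 1))) (+-cong (sym t-2-1) (sym p·t-2-2)) ⟩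
      1-q²^ 1 * (t 2 1 k + q²^ 1 * t 2 2 k) ∎

  Λ-difference : ∀ j → Λ j - Λ (suc j) ≈ tsum (λ k → mono (j ℕ.* j) * 𝓛-terms j k - mono (suc j ℕ.* suc j) * 𝓛-terms (suc j) k)
  Λ-difference j = trans (+-cong (⊛-distribˡ-tsum _ _ (𝓛-summable j))
                                 (trans (-‿cong (⊛-distribˡ-tsum _ _ (𝓛-summable (suc j)))) (sym (tsum-⊖ _))))
                         (sym (tsum-⊕ _ _))

  Λ-step₀ : Λ 0 ≈ I * tail-term 0 + Λ 1
  Λ-step₀ = difference⇒step (begin
    Λ 0 - Λ 1
      ≈⟨ trans (Λ-difference 0) (tsum-cong Step₀.difference) ⟩
    tsum (λ k → 1-q²^ 1 * F k)
      ≈⟨ ⊛-distribˡ-tsum (1-q²^ 1) F F-summable ⟨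
    1-q²^ 1 * tsum F
      ≈⟨ *-congˡ (trans (tsum-⊕ _ _) (+-congˡ (sym (⊛-distribˡ-tsum (q²^ 1) (t 2 2) (t-summable 2 2))))) ⟩
    1-q²^ 1 * (D 2 1 + p * D 2 2)
      ≈⟨ *-congˡ (+-congʳ (D-rec-b 2 1)) ⟩
    1-q²^ 1 * ((D 2 2 + q²^ 2 * D 3 3) + p * D 2 2)
      ≈⟨ *-congˡ (+-cong (+-cong (cauchy 2) (*-cong (sym (q²^-+ 1 1)) (cauchy 3))) (*-congˡ (cauchy 2))) ⟩
    (1# - p) * ((I + (p * p) * I) + p * I)
      ≈⟨ solve 2 (λ p I → (𝟙 :- p) :* ((I :+ (p :* p) :* I) :+ p :* I) := I :* ((𝟙 :- p :* (p :* p)) :* 𝟙)) refl p I ⟩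
    I * ((1# - p * (p * p)) * 1#)
      ≈⟨ *-congˡ (*-cong (+-congˡ (-‿cong (trans (*-congˡ (q²^-+ 1 1)) (q²^-+ 1 2)))) (sym mono-0)) ⟩
    I * tail-term 0 ∎)
    where
    p = q²^ 1
    F : ℕ → PS
    F k = t 2 1 k + p * t 2 2 k
    F-summable : Summable F
    F-summable k = Ord≥-⊕ (t-summable 2 1 k) (Ord≥-⊛ʳ k (t-summable 2 2 k))

  -- For j = i + 1 ≥ 1, the difference Λ j - Λ (j + 1) is C · Σ_k V k with V k = t a b k - p^(2j) t a a k,
  -- a = 2j + 1 and b = 2j - 1; the Cauchy identity evaluates Σ_k V k.
  module Step (i : ℕ) where
    j = suc i
    a = suc (suc (suc (2 ℕ.* i)))
    b = suc (2 ℕ.* i)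
    S = mono (j ℕ.* j)
    S′ = mono (suc j ℕ.* suc j)
    g = mono a
    P = q²^ (suc b)
    Q = q²^ (i ℕ.* i ℕ.+ 1 ℕ.* i)
    C = (S * S) * ((1# - g * g) * Q)

    V : ℕ → PS
    V k = t a b k - P * t a a k

    V-summable : Summable V
    V-summable k = Ord≥-⊕ (t-summable a b k) (Ord≥-⊖ (Ord≥-⊛ʳ k (t-summable a a k)))

    [j+1]²≡j²+a : suc (suc i) ℕ.* suc (suc i) ≡ suc i ℕ.* suc i ℕ.+ suc (suc (suc (2 ℕ.* i)))
    [j+1]²≡j²+a = ℕSolver.solve (i ∷ [])
    2a≡a+a : 2 ℕ.* suc (suc (suc (2 ℕ.* i))) ≡ suc (suc (suc (2 ℕ.* i))) ℕ.+ suc (suc (suc (2 ℕ.* i)))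
    2a≡a+a = ℕSolver.solve (i ∷ [])

    S′≈S*g : S′ ≈ S * g
    S′≈S*g = monomial-≈ q^⟨ suc j ℕ.* suc j ⟩ (q^⟨ j ℕ.* j ⟩ ·ₘ q^⟨ a ⟩) [j+1]²≡j²+a

    q²^a≈g*g : q²^ a ≈ g * g
    q²^a≈g*g = monomial-≈ q^⟨ 2 ℕ.* a ⟩ (q^⟨ a ⟩ ·ₘ q^⟨ a ⟩) 2a≡a+a

    module Pair (k : ℕ) where
      m = suc k ℕ.+ i
      Pb = q²^ (suc k ℕ.* suc k ℕ.+ b ℕ.* suc k)
      Pw = q²^ (2 ℕ.* suc m)
      Y = invPoch (suc k)
      X = q²^ (suc k)
      Z = invPoch (suc k ℕ.+ a)
      MO = (Q * Pb) * (1# - Pw)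

      M-exponent : 2 ℕ.* (suc k ℕ.+ i) ℕ.* (suc k ℕ.+ i) ℕ.+ 2 ℕ.* (suc k ℕ.+ i)
                 ≡ 2 ℕ.* ((i ℕ.* i ℕ.+ 1 ℕ.* i) ℕ.+ (suc k ℕ.* suc k ℕ.+ suc (2 ℕ.* i) ℕ.* suc k))
      M-exponent = ℕSolver.solve (k ∷ i ∷ [])
      index-j : suc (suc (suc k ℕ.+ i) ℕ.+ suc i) ≡ suc k ℕ.+ suc (suc (suc (2 ℕ.* i)))
      index-j = ℕSolver.solve (k ∷ i ∷ [])
      index-j+1 : suc (k ℕ.+ suc i) ℕ.+ suc (suc i) ≡ suc k ℕ.+ suc (suc (suc (2 ℕ.* i)))
      index-j+1 = ℕSolver.solve (k ∷ i ∷ [])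
      g·g·X : 2 ℕ.* (suc k ℕ.+ suc (suc (suc (2 ℕ.* i)))) ≡ suc (suc (suc (2 ℕ.* i))) ℕ.+ suc (suc (suc (2 ℕ.* i))) ℕ.+ 2 ℕ.* suc k
      g·g·X = ℕSolver.solve (k ∷ i ∷ [])
      P·Pa : (suc k ℕ.* suc k ℕ.+ suc (2 ℕ.* i) ℕ.* suc k) ℕ.+ 2 ℕ.* suc (suc k ℕ.+ i)
           ≡ suc (suc (2 ℕ.* i)) ℕ.+ (suc k ℕ.* suc k ℕ.+ suc (suc (suc (2 ℕ.* i))) ℕ.* suc k)
      P·Pa = ℕSolver.solve (k ∷ i ∷ [])

      M-m : M m ≈ MO
      M-m = *-congʳ (trans (mono-cong M-exponent) (sym (q²^-+ (i ℕ.* i ℕ.+ 1 ℕ.* i) (suc k ℕ.* suc k ℕ.+ b ℕ.* suc k))))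

      T-m-j : T m j ≈ MO * (S * (Y * (Z * (1# - g * g * X))))
      T-m-j = *-cong M-m (*-congˡ (*-cong (reflexive (invPochDiff-+ (suc k) i))
                (trans (invPoch-split (suc m ℕ.+ suc i) index-j)
                       (*-congˡ (+-congˡ (-‿cong (monomial-≈ q^⟨ 2 ℕ.* (suc k ℕ.+ a) ⟩ (q^⟨ a ⟩ ·ₘ q^⟨ a ⟩ ·ₘ q^⟨ 2 ℕ.* suc k ⟩) g·g·X)))))))

      T-m-j+1 : T (k ℕ.+ suc i) (suc j) ≈ MO * ((S * g) * ((Y * (1# - X)) * Z))
      T-m-j+1 = *-cong (trans (reflexive (≡.cong M (ℕP.+-suc k i))) M-m)
                       (*-cong S′≈S*g (*-cong (trans (reflexive (invPochDiff-+ k (suc i))) (invPoch-split k ≡.refl)) (invPoch-cong index-j+1)))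

      pair : S * T m j - S′ * T (k ℕ.+ suc i) (suc j) ≈ C * V (suc k)
      pair = begin
        S * T m j - S′ * T (k ℕ.+ suc i) (suc j)
          ≈⟨ +-cong (*-congˡ T-m-j) (-‿cong (*-cong S′≈S*g T-m-j+1)) ⟩
        S * (MO * (S * (Y * (Z * (1# - g * g * X))))) - (S * g) * (MO * ((S * g) * ((Y * (1# - X)) * Z)))
          ≈⟨ solve 8 (λ S g Q Pb Pw Y X Z →
               S :* (((Q :* Pb) :* (𝟙 :- Pw)) :* (S :* (Y :* (Z :* (𝟙 :- g :* g :* X)))))
               :- (S :* g) :* (((Q :* Pb) :* (𝟙 :- Pw)) :* ((S :* g) :* ((Y :* (𝟙 :- X)) :* Z)))
               := ((S :* S) :* ((𝟙 :- g :* g) :* Q)) :* (Pb :* (Y :* Z) :- (Pb :* Pw) :* (Y :* Z)))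
               refl S g Q Pb Pw Y X Z ⟩
        C * (Pb * (Y * Z) - (Pb * Pw) * (Y * Z))
          ≈⟨ *-congˡ (+-congˡ (-‿cong (trans (*-congʳ (q²^-regroup (suc k ℕ.* suc k ℕ.+ b ℕ.* suc k) (2 ℕ.* suc m) (suc b) (suc k ℕ.* suc k ℕ.+ a ℕ.* suc k) P·Pa)) (*-assoc _ _ _)))) ⟩
        C * V (suc k) ∎

    head : S * T i j ≈ C * V 0
    head = begin
      S * (M i * (S * (invPochDiff i i * invPoch (j ℕ.+ j))))
        ≈⟨ *-congˡ (*-cong M-i (*-congˡ (*-cong (reflexive (invPochDiff-+ 0 i)) invPoch-2j))) ⟩
      S * ((Q * (1# - P)) * (S * (1# * (Za * (1# - g * g)))))
        ≈⟨ solve 5 (λ S g Q P Za → S :* ((Q :* (𝟙 :- P)) :* (S :* (𝟙 :* (Za :* (𝟙 :- g :* g)))))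
                                  := ((S :* S) :* ((𝟙 :- g :* g) :* Q)) :* (𝟙 :* (𝟙 :* Za) :- P :* (𝟙 :* (𝟙 :* Za)))) refl S g Q P Za ⟩
      C * (1# * (1# * Za) - P * (1# * (1# * Za)))
        ≈⟨ *-congˡ (+-cong (sym (t-zero b)) (-‿cong (*-congˡ (sym (t-zero a))))) ⟩
      C * V 0 ∎
      where
      Za = invPoch a
      M-exponent : 2 ℕ.* i ℕ.* i ℕ.+ 2 ℕ.* i ≡ 2 ℕ.* (i ℕ.* i ℕ.+ 1 ℕ.* i)
      M-exponent = ℕSolver.solve (i ∷ [])
      P-exponent : 2 ℕ.* (2 ℕ.* suc i) ≡ 2 ℕ.* suc (suc (2 ℕ.* i))
      P-exponent = ℕSolver.solve (i ∷ [])
      index-2j : suc (suc i ℕ.+ suc i) ≡ suc (suc (suc (2 ℕ.* i)))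
      index-2j = ℕSolver.solve (i ∷ [])
      M-i : M i ≈ Q * (1# - P)
      M-i = *-cong (mono-cong M-exponent) (+-congˡ (-‿cong (mono-cong P-exponent)))
      invPoch-2j : invPoch (j ℕ.+ j) ≈ Za * (1# - g * g)
      invPoch-2j = trans (invPoch-split (j ℕ.+ j) index-2j) (*-congˡ (+-congˡ (-‿cong q²^a≈g*g)))
      t-zero : ∀ b′ → t a b′ 0 ≈ 1# * (1# * Za)
      t-zero b′ = *-congʳ (trans (mono-cong (≡.cong (2 ℕ.*_) (ℕP.*-zeroʳ b′))) mono-0)

    [b+1]+[a+1]≡a+a : suc (suc (2 ℕ.* i)) ℕ.+ suc (suc (suc (suc (2 ℕ.* i)))) ≡ suc (suc (suc (2 ℕ.* i))) ℕ.+ suc (suc (suc (2 ℕ.* i)))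
    [b+1]+[a+1]≡a+a = ℕSolver.solve (i ∷ [])
    6a≡12j+6 : suc (suc (suc (2 ℕ.* i))) ℕ.+ suc (suc (suc (2 ℕ.* i))) ℕ.+ (suc (suc (suc (2 ℕ.* i))) ℕ.+ suc (suc (suc (2 ℕ.* i))) ℕ.+ (suc (suc (suc (2 ℕ.* i))) ℕ.+ suc (suc (suc (2 ℕ.* i)))))
             ≡ 12 ℕ.* suc i ℕ.+ 6
    6a≡12j+6 = ℕSolver.solve (i ∷ [])
    2j²+2[i²+i] : suc i ℕ.* suc i ℕ.+ suc i ℕ.* suc i ℕ.+ 2 ℕ.* (i ℕ.* i ℕ.+ 1 ℕ.* i) ≡ 4 ℕ.* i ℕ.* i ℕ.+ 6 ℕ.* i ℕ.+ 2
    2j²+2[i²+i] = ℕSolver.solve (i ∷ [])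

    ΣV : D a b - P * D a a ≈ ((1# + g * g) + (g * g) * (g * g)) * I
    ΣV = begin
      D a b - P * D a a
        ≈⟨ +-congʳ (trans (D-rec-b a b) (+-cong (D-rec-b a (suc b)) (*-congˡ (D-rec-b (suc a) a)))) ⟩
      ((D a a + q²^ a * D (suc a) (suc a)) + P * (D (suc a) (suc a) + q²^ (suc a) * D (suc (suc a)) (suc (suc a)))) - P * D a a
        ≈⟨ +-cong (+-cong (+-cong (cauchy a) (*-congˡ (cauchy (suc a)))) (*-congˡ (+-cong (cauchy (suc a)) (*-congˡ (cauchy (suc (suc a)))))))
                  (-‿cong (*-congˡ (cauchy a))) ⟩
      ((I + q²^ a * I) + P * (I + q²^ (suc a) * I)) - P * I
        ≈⟨ solve 4 (λ I G P P′ → ((I :+ G :* I) :+ P :* (I :+ P′ :* I)) :- P :* I := ((𝟙 :+ G) :+ P :* P′) :* I) refl I (q²^ a) P (q²^ (suc a)) ⟩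
      ((1# + q²^ a) + P * q²^ (suc a)) * I
        ≈⟨ *-congʳ (+-cong (+-congˡ q²^a≈g*g) (trans (q²^-regroup (suc b) (suc a) a a [b+1]+[a+1]≡a+a) (*-cong q²^a≈g*g q²^a≈g*g))) ⟩
      ((1# + g * g) + (g * g) * (g * g)) * I ∎

    closing : C * (((1# + g * g) + (g * g) * (g * g)) * I) ≈ I * tail-term j
    closing = begin
      C * (((1# + g * g) + (g * g) * (g * g)) * I)
        ≈⟨ solve 4 (λ S g Q I → ((S :* S) :* ((𝟙 :- g :* g) :* Q)) :* (((𝟙 :+ g :* g) :+ (g :* g) :* (g :* g)) :* I)
                               := I :* ((𝟙 :- (g :* g) :* ((g :* g) :* (g :* g))) :* ((S :* S) :* Q))) refl S g Q I ⟩
      I * ((1# - (g * g) * ((g * g) * (g * g))) * ((S * S) * Q))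
        ≈⟨ *-congˡ (*-cong (+-congˡ (-‿cong g⁶)) S²Q) ⟩
      I * tail-term j ∎
      where
      g⁶ : (g * g) * ((g * g) * (g * g)) ≈ mono (12 ℕ.* j ℕ.+ 6)
      g⁶ = monomial-≈ ((q^⟨ a ⟩ ·ₘ q^⟨ a ⟩) ·ₘ ((q^⟨ a ⟩ ·ₘ q^⟨ a ⟩) ·ₘ (q^⟨ a ⟩ ·ₘ q^⟨ a ⟩))) q^⟨ 12 ℕ.* j ℕ.+ 6 ⟩ 6a≡12j+6
      S²Q : (S * S) * Q ≈ mono (rhsExponent j)
      S²Q = trans (monomial-≈ (q^⟨ j ℕ.* j ⟩ ·ₘ q^⟨ j ℕ.* j ⟩ ·ₘ q^⟨ 2 ℕ.* (i ℕ.* i ℕ.+ 1 ℕ.* i) ⟩) q^⟨ 4 ℕ.* i ℕ.* i ℕ.+ 6 ℕ.* i ℕ.+ 2 ⟩ 2j²+2[i²+i])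
                  (mono-cong (≡.sym (rhsExponent-suc i)))

    step : Λ j ≈ I * tail-term j + Λ (suc j)
    step = difference⇒step (begin
      Λ j - Λ (suc j)
        ≈⟨ +-cong (trans (⊛-distribˡ-tsum S _ (𝓛-summable j)) (tsum-head _ (λ k → Ord≥-⊛ʳ k (𝓛-summable j k))))
                  (-‿cong (⊛-distribˡ-tsum S′ _ (𝓛-summable (suc j)))) ⟩
      (S * T i j + tsum (λ k → S * T (suc k ℕ.+ i) j)) - tsum (λ k → S′ * T (k ℕ.+ suc i) (suc j))
        ≈⟨ trans (+-assoc _ _ _) (+-congˡ (trans (+-congˡ (sym (tsum-⊖ _))) (sym (tsum-⊕ _ _)))) ⟩
      S * T i j + tsum (λ k → S * T (suc k ℕ.+ i) j - S′ * T (k ℕ.+ suc i) (suc j))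
        ≈⟨ +-cong head (tsum-cong Pair.pair) ⟩
      C * V 0 + tsum (λ k → C * V (suc k))
        ≈⟨ tsum-head (λ k → C * V k) (λ k → Ord≥-⊛ʳ k (V-summable k)) ⟨
      tsum (λ k → C * V k)
        ≈⟨ ⊛-distribˡ-tsum C V V-summable ⟨
      C * tsum V
        ≈⟨ *-congˡ (trans (tsum-⊕ _ _) (+-congˡ (trans (tsum-⊖ _) (-‿cong (sym (⊛-distribˡ-tsum P (t a a) (t-summable a a))))))) ⟩
      C * (D a b - P * D a a)
        ≈⟨ trans (*-congˡ ΣV) closing ⟩
      I * tail-term j ∎)

  Λ-step : ∀ j → Λ j ≈ I * tail-term j + Λ (suc j)
  Λ-step zero    = Λ-step₀
  Λ-step (suc i) = Step.step i

  coefficient-identity : ∀ j → 𝓛 j ≈ I * 𝓡 j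
  coefficient-identity j = mono-cancel (j ℕ.* j) (begin
    Λ j                          ≈⟨ telescoping-unique Λ-step (λ j → trans (*-congˡ (tail-step j)) (distribˡ _ _ _))
                                                       Ord≥-Λ (λ j → Ord≥-⊛ʳ j (Ord≥-tail j)) j ⟩
    I * tail j                   ≈⟨ *-congˡ (q^j²-𝓡 j) ⟨
    I * (mono (j ℕ.* j) * 𝓡 j)   ≈⟨ x∙yz≈y∙xz _ _ _ ⟩
    mono (j ℕ.* j) * (I * 𝓡 j)   ∎)

module BothSides {c ℓ} (R : CommutativeRing c ℓ) (x : CommutativeRing.Carrier R) where
  open Series R using (PS; mono; tsum; invPoch; invPochInf; prodPS; lhsTerm; rhsTerm; LHS; RHS)
  open PowerSeries R hiding (module ℙ)
  open InfiniteSums R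
  open Chebyshev R x using (W)
  open ProductExpansion R x using (factor; WG; product-expansion)
  open CoefficientIdentity R
  open CommutativeRing powerSeriesRing
  open import Algebra.Properties.CommutativeSemigroup *-commutativeSemigroup using (x∙yz≈y∙xz; interchange)
  open import Relation.Binary.Reasoning.Setoid setoid
  module Σₚ-Props = FiniteSums powerSeriesRing

  lhsTerm-expansion : ∀ m → lhsTerm x m ≈ Σₚ.Σ≤ (suc m) (λ j → const (W j) * T m j)
  lhsTerm-expansion m = begin
    lhsTerm x m
      ≈⟨ trans (sym (⊛≈⊗ _ _)) (*-congʳ (sym (⊛≈⊗ _ _))) ⟩
    (q^e * prodPS (suc m) factor) * invPoch (2 ℕ.* m ℕ.+ 1)
      ≈⟨ *-congˡ (invPoch-split (2 ℕ.* m ℕ.+ 1) index) ⟩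
    (q^e * prodPS (suc m) factor) * (invPoch (2 ℕ.* suc m) * 1-q²^ (2 ℕ.* suc m))
      ≈⟨ trans (*-congˡ (*-comm _ _)) (interchange _ _ _ _) ⟩
    M m * (prodPS (suc m) factor * invPoch (2 ℕ.* suc m))
      ≈⟨ *-congˡ (product-expansion (suc m)) ⟩
    M m * Σₚ.Σ≤ (suc m) (WG (suc m))
      ≈⟨ Σₚ-Props.*-distribˡ-Σ (suc (suc m)) _ _ ⟩
    Σₚ.Σ≤ (suc m) (λ j → M m * WG (suc m) j)
      ≈⟨ Σₚ-Props.Σ-cong (suc (suc m)) (λ j → x∙yz≈y∙xz _ _ _) ⟩
    Σₚ.Σ≤ (suc m) (λ j → const (W j) * T m j) ∎
    where
    q^e = mono (2 ℕ.* m ℕ.* m ℕ.+ 2 ℕ.* m)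
    index : suc (2 ℕ.* m ℕ.+ 1) ≡ 2 ℕ.* suc m
    index = ℕSolver.solve (m ∷ [])

  LHS-expansion : LHS x ≈ tsum (λ j → const (W j) * 𝓛 j)
  LHS-expansion = begin
    tsum (lhsTerm x)
      ≈⟨ tsum-cong (λ m → trans (lhsTerm-expansion m) (Σₚ-Props.Σ-head (suc m) _)) ⟩
    tsum (λ m → const (W 0) * T m 0 + Σₚ.Σ≤ m (λ i → const (W (suc i)) * T m (suc i)))
      ≈⟨ tsum-⊕ _ _ ⟩
    tsum (λ m → const (W 0) * T m 0) + tsum (λ m → Σₚ.Σ≤ m (λ i → const (W (suc i)) * T m (suc i)))
      ≈⟨ +-cong (sym (⊛-distribˡ-tsum _ _ (𝓛-summable 0)))
                (trans (tsum-triangle _ (λ k i → Ord≥-⊛ʳ (k ℕ.+ i) (Ord≥-T (k ℕ.+ i) (suc i))))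
                       (tsum-cong (λ i → sym (⊛-distribˡ-tsum _ _ (𝓛-summable (suc i)))))) ⟩
    const (W 0) * 𝓛 0 + tsum (λ i → const (W (suc i)) * 𝓛 (suc i))
      ≈⟨ tsum-head _ (λ j → Ord≥-⊛ʳ j (Ord≥-𝓛 j)) ⟨
    tsum (λ j → const (W j) * 𝓛 j) ∎

  rhsTerm-expansion : ∀ n → rhsTerm x n ≈ Σₚ.Σ≤ n (λ j → const (W j) * (1-q^ (12 ℕ.* n ℕ.+ 6) * mono (rhsExponent n ∸ j ℕ.* j)))
  rhsTerm-expansion n = begin
    rhsTerm x n
      ≈⟨ sym (⊛≈⊗ _ _) ⟩
    1-q^ (12 ℕ.* n ℕ.+ 6) * (λ k → Σ≤ n (λ j → W j Coeff.* q^e j k))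
      ≈⟨ *-congˡ (λ k → Coeff.sym (Σₚ-coeff (suc n) (λ j → W j · q^e j) k)) ⟩
    1-q^ (12 ℕ.* n ℕ.+ 6) * Σₚ.Σ≤ n (λ j → W j · q^e j)
      ≈⟨ *-congˡ (Σₚ-Props.Σ-cong (suc n) (λ j → ·≈const-⊛ (W j) (q^e j))) ⟩
    1-q^ (12 ℕ.* n ℕ.+ 6) * Σₚ.Σ≤ n (λ j → const (W j) * q^e j)
      ≈⟨ trans (Σₚ-Props.*-distribˡ-Σ (suc n) _ _) (Σₚ-Props.Σ-cong (suc n) (λ j → x∙yz≈y∙xz _ _ _)) ⟩
    Σₚ.Σ≤ n (λ j → const (W j) * (1-q^ (12 ℕ.* n ℕ.+ 6) * q^e j)) ∎
    where
    open Series R using (Σ≤; _·_)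
    module Coeff = CommutativeRing R
    q^e : ℕ → PS
    q^e j = mono (rhsExponent n ∸ j ℕ.* j)

  RHS-expansion : RHS x ≈ tsum (λ j → const (W j) * (I * 𝓡 j))
  RHS-expansion = begin
    invPochInf ⊗ tsum (rhsTerm x)
      ≈⟨ sym (⊛≈⊗ _ _) ⟩
    I * tsum (rhsTerm x)
      ≈⟨ *-congˡ (trans (tsum-cong rhsTerm-expansion) (tsum-triangle _ (λ k j → Ord≥-⊛ʳ (k ℕ.+ j) (Ord≥-𝓡-terms j k)))) ⟩
    I * tsum (λ j → tsum (λ k → const (W j) * 𝓡-terms j k))
      ≈⟨ *-congˡ (tsum-cong (λ j → sym (⊛-distribˡ-tsum _ _ (𝓡-summable j)))) ⟩
    I * tsum (λ j → const (W j) * 𝓡 j)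
      ≈⟨ ⊛-distribˡ-tsum I _ (λ j → Ord≥-⊛ʳ j (Ord≥-𝓡 j)) ⟩
    tsum (λ j → I * (const (W j) * 𝓡 j))
      ≈⟨ tsum-cong (λ j → x∙yz≈y∙xz _ _ _) ⟩
    tsum (λ j → const (W j) * (I * 𝓡 j)) ∎
    where open Series R using (_⊗_)

theorem7p5 : ∀ {c ℓ} (R : CommutativeRing c ℓ) (x : CommutativeRing.Carrier R) (N : ℕ) →
               CommutativeRing._≈_ R (Series.LHS R x N) (Series.RHS R x N)
theorem7p5 R x = begin
  LHS x                                 ≈⟨ LHS-expansion ⟩
  tsum (λ j → const (W j) * 𝓛 j)         ≈⟨ tsum-cong (λ j → *-congˡ (coefficient-identity j)) ⟩
  tsum (λ j → const (W j) * (I * 𝓡 j))   ≈⟨ RHS-expansion ⟨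
  RHS x                                 ∎
  where
  open Series R using (LHS; RHS; tsum)
  open PowerSeries R using (powerSeriesRing; const)
  open InfiniteSums R using (tsum-cong)
  open Chebyshev R x using (W)
  open CoefficientIdentity R using (I; 𝓛; 𝓡; coefficient-identity)
  open BothSides R x using (LHS-expansion; RHS-expansion)
  open CommutativeRing powerSeriesRing using (setoid; _*_; *-congˡ)
  open import Relation.Binary.Reasoning.Setoid setoid
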